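{- Let $\mathbb{K}$ be a commutative ring in which $n!$ is invertible, and let $R$ be a $\mathbb{K}$-algebra generated by $\{r_i\}_{i\in I}$. Then the $\mathbb{K}$-algebra $\Gamma^n_{\mathbb{K}}(R)$ is generated by the elements $1^{[n-1]}\times\upsilon^{[1]}$ where $\upsilon$ varies among the monomials in the $r_i$. If $R$ is commutative, the monomials $\upsilon$ can be taken of degree not greater than $n$.
   Context: For a $\mathbb{K}$-module $M$, the divided powers algebra $\Gamma_{\mathbb{K}}(M)$ is the commutative $\mathbb{K}$-algebra (product $\times$) generated by symbols $m^{[k]}$, $m\in M$, $k\in\mathbb{Z}$, subject to: $m^{[i]}=0$ for $i<0$; $m^{[0]}=1$; $(am)^{[i]}=a^im^{[i]}$ for $a\in\mathbb{K}$; $(m+m')^{[k]}=\sum_{i+j=k}m^{[i]}\times m'^{[j]}$; $m^{[i]}\times m^{[j]}=\binom{i+j}{i}m^{[i+j]}$. It is graded, $\Gamma^n_{\mathbb{K}}(M)$ being spanned by products $\times_i m_i^{[\alpha_i]}$ with $\sum\alpha_i=n$. For a $\mathbb{K}$-algebra $R$, $\Gamma^n_{\mathbb{K}}(R)$ carries a (different) $\mathbb{K}$-algebra structure, with unit $1^{[n]}$, characterized by $a^{[n]}b^{[n]}=(ab)^{[n]}$ for $a,b\in R$; "generated" refers to this algebra structure. A monomial in the $r_i$ is a finite product $r_{i_1}\cdots r_{i_d}$ ($d\ge1$ its degree). -}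

module Defs where

open import Level using (Level; _⊔_) renaming (suc to lsuc)
open import Algebra.Bundles using (CommutativeRing; Ring)
open import Data.Nat.Base using (ℕ; zero; suc; _∸_; _≤_; _!)
open import Data.Nat.Combinatorics using (_C_)
open import Data.List.Base using (List; []; _∷_)
open import Data.List.NonEmpty.Base using (List⁺; _∷_; length)
open import Data.Product.Base using (Σ; ∃; _×_; _,_)
open import Relation.Binary.PropositionalEquality.Core using (_≡_)

import Data.Nat.Base as ℕ

module _ {c ℓ} (K : CommutativeRing c ℓ) where
  open CommutativeRing K

  fromℕ : ℕ → Carrier
  fromℕ zero    = 0#
  fromℕ (suc k) = 1# + fromℕ k

  pow : Carrier → ℕ → Carrier
  pow a zero    = 1#
  pow a (suc i) = a * pow a i

  FactorialInvertible : ℕ → Set (c ⊔ ℓ)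
  FactorialInvertible n = Σ Carrier λ u → (u * fromℕ (n !)) ≈ 1#

-- (Associative, unital, not necessarily commutative) K-algebras:
-- a ring R together with a K-module structure whose scalars are central.

record KAlgebra {c ℓ} (K : CommutativeRing c ℓ) a ℓa : Set (c ⊔ ℓ ⊔ lsuc (a ⊔ ℓa)) where
  private module K = CommutativeRing K
  field
    ring : Ring a ℓa
  open Ring ring public
  infixr 7 _·_
  field
    _·_        : K.Carrier → Carrier → Carrier
    ·-cong     : ∀ {α β x y} → α K.≈ β → x ≈ y → (α · x) ≈ (β · y)
    ·-distribˡ : ∀ α x y → (α · (x + y)) ≈ ((α · x) + (α · y))
    ·-distribʳ : ∀ α β x → ((α K.+ β) · x) ≈ ((α · x) + (β · x))
    ·-assoc    : ∀ α β x → ((α K.* β) · x) ≈ (α · (β · x))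
    ·-identity : ∀ x → (K.1# · x) ≈ x
    ·-*ˡ       : ∀ α x y → (α · (x * y)) ≈ ((α · x) * y)
    ·-*ʳ       : ∀ α x y → (α · (x * y)) ≈ (x * (α · y))

IsCommutativeAlg : ∀ {c ℓ a ℓa} {K : CommutativeRing c ℓ} → KAlgebra K a ℓa → Set (a ⊔ ℓa)
IsCommutativeAlg A = ∀ x y → (x * y) ≈ (y * x)
  where open KAlgebra A

module _ {c ℓ a ℓa} {K : CommutativeRing c ℓ} (A : KAlgebra K a ℓa)
         {ι} {I : Set ι} (r : I → KAlgebra.Carrier A) where
  open KAlgebra A using (Carrier; _≈_; _+_; _*_; 1#; _·_)

  data GeneratedR : Carrier → Set (c ⊔ a ⊔ ℓa ⊔ ι) where
    gr-gen : ∀ i → GeneratedR (r i)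
    gr-1   : GeneratedR 1#
    gr-+   : ∀ {x y} → GeneratedR x → GeneratedR y → GeneratedR (x + y)
    gr-·   : ∀ α {x} → GeneratedR x → GeneratedR (α · x)
    gr-*   : ∀ {x y} → GeneratedR x → GeneratedR y → GeneratedR (x * y)
    gr-≈   : ∀ {x y} → x ≈ y → GeneratedR x → GeneratedR y

  GeneratedBy : Set (c ⊔ a ⊔ ℓa ⊔ ι)
  GeneratedBy = ∀ x → GeneratedR x

  -- the monomial r_{i₁} ⋯ r_{i_d} attached to a nonempty word i₁ … i_d
  -- (its degree is the length of the word)
  evalWord : I → List I → Carrier
  evalWord i []       = r i
  evalWord i (j ∷ js) = r i * evalWord j js

  monomial : List⁺ I → Carrier
  monomial (i ∷ is) = evalWord i is

-- The divided powers algebra Γ_K(M) of the underlying K-module M of R,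
-- presented by generators and relations (as a setoid), its graded piece
-- Γ^n_K(M), the K-algebra structure on Γ^n_K(R), and generated subalgebras.

module Divided {c ℓ a ℓa} (K : CommutativeRing c ℓ) (A : KAlgebra K a ℓa) where
  private module K = CommutativeRing K
  open KAlgebra A using (Carrier; _≈_; _+_; _*_; 1#; _·_)

  infixl 6 _⊕_
  infixl 7 _⊗_
  infixr 8 _⊙_

  -- formal expressions in the commutative K-algebra generated by m^{[i]}
  -- (negative indices are omitted: m^{[i]} = 0 for i < 0)
  data Tm : Set (c ⊔ a) where
    [_]^[_] : Carrier → ℕ → Tm
    𝟘 𝟙    : Tm
    _⊕_    : Tm → Tm → Tm
    _⊗_    : Tm → Tm → Tm
    ⊖_     : Tm → Tm
    _⊙_    : K.Carrier → Tm → Tm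

  sumTo : (ℕ → Tm) → ℕ → Tm
  sumTo f zero    = f zero
  sumTo f (suc k) = sumTo f k ⊕ f (suc k)

  infix 4 _∼_
  data _∼_ : Tm → Tm → Set (c ⊔ ℓ ⊔ a ⊔ ℓa) where
    ∼-refl  : ∀ {x} → x ∼ x
    ∼-sym   : ∀ {x y} → x ∼ y → y ∼ x
    ∼-trans : ∀ {x y z} → x ∼ y → y ∼ z → x ∼ z
    gen-cong : ∀ {m m′} i → m ≈ m′ → [ m ]^[ i ] ∼ [ m′ ]^[ i ]
    ⊕-cong  : ∀ {x x′ y y′} → x ∼ x′ → y ∼ y′ → x ⊕ y ∼ x′ ⊕ y′
    ⊗-cong  : ∀ {x x′ y y′} → x ∼ x′ → y ∼ y′ → x ⊗ y ∼ x′ ⊗ y′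
    ⊖-cong  : ∀ {x x′} → x ∼ x′ → ⊖ x ∼ ⊖ x′
    ⊙-cong  : ∀ {α β x x′} → α K.≈ β → x ∼ x′ → α ⊙ x ∼ β ⊙ x′
    ⊕-assoc : ∀ x y z → (x ⊕ y) ⊕ z ∼ x ⊕ (y ⊕ z)
    ⊕-comm  : ∀ x y → x ⊕ y ∼ y ⊕ x
    ⊕-idˡ   : ∀ x → 𝟘 ⊕ x ∼ x
    ⊖-invˡ  : ∀ x → (⊖ x) ⊕ x ∼ 𝟘
    ⊗-assoc : ∀ x y z → (x ⊗ y) ⊗ z ∼ x ⊗ (y ⊗ z)
    ⊗-comm  : ∀ x y → x ⊗ y ∼ y ⊗ x
    ⊗-idˡ   : ∀ x → 𝟙 ⊗ x ∼ x
    ⊗-distribˡ : ∀ x y z → x ⊗ (y ⊕ z) ∼ (x ⊗ y) ⊕ (x ⊗ z)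
    ⊙-distribˡ : ∀ α x y → α ⊙ (x ⊕ y) ∼ (α ⊙ x) ⊕ (α ⊙ y)
    ⊙-distribʳ : ∀ α β x → (α K.+ β) ⊙ x ∼ (α ⊙ x) ⊕ (β ⊙ x)
    ⊙-assoc    : ∀ α β x → (α K.* β) ⊙ x ∼ α ⊙ (β ⊙ x)
    ⊙-identity : ∀ x → K.1# ⊙ x ∼ x
    ⊙-⊗        : ∀ α x y → α ⊙ (x ⊗ y) ∼ (α ⊙ x) ⊗ y
    dp-zero : ∀ m → [ m ]^[ 0 ] ∼ 𝟙
    dp-scal : ∀ α m i → [ α · m ]^[ i ] ∼ pow K α i ⊙ [ m ]^[ i ]
    dp-add  : ∀ m m′ k →
              [ m + m′ ]^[ k ] ∼ sumTo (λ i → [ m ]^[ i ] ⊗ [ m′ ]^[ k ∸ i ]) k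
    dp-mul  : ∀ m i j →
              [ m ]^[ i ] ⊗ [ m ]^[ j ] ∼ fromℕ K ((i ℕ.+ j) C i) ⊙ [ m ]^[ i ℕ.+ j ]

  data Monomial : ℕ → Tm → Set (c ⊔ a) where
    mono-𝟙   : Monomial 0 𝟙
    mono-gen : ∀ m i → Monomial i [ m ]^[ i ]
    mono-⊗   : ∀ {d e x y} → Monomial d x → Monomial e y → Monomial (d ℕ.+ e) (x ⊗ y)

  data InΓ (n : ℕ) : Tm → Set (c ⊔ ℓ ⊔ a ⊔ ℓa) where
    span-mono : ∀ {x} → Monomial n x → InΓ n x
    span-𝟘    : InΓ n 𝟘
    span-⊕    : ∀ {x y} → InΓ n x → InΓ n y → InΓ n (x ⊕ y)
    span-⊙    : ∀ α {x} → InΓ n x → InΓ n (α ⊙ x)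
    span-∼    : ∀ {x y} → x ∼ y → InΓ n x → InΓ n y

  -- the K-algebra multiplication on Γ^n_K(R): a K-bilinear, well-defined
  -- operation on Γ^n_K(R) with a^{[n]} b^{[n]} = (ab)^{[n]}
  -- (this characterizes it uniquely)
  record GammaMult (n : ℕ) : Set (c ⊔ ℓ ⊔ a ⊔ ℓa) where
    infixl 7 _⋆_
    field
      _⋆_        : Tm → Tm → Tm
      ⋆-closed   : ∀ {x y} → InΓ n x → InΓ n y → InΓ n (x ⋆ y)
      ⋆-cong     : ∀ {x x′ y y′} → InΓ n x → InΓ n x′ → InΓ n y → InΓ n y′ →
                   x ∼ x′ → y ∼ y′ → x ⋆ y ∼ x′ ⋆ y′
      ⋆-distribʳ : ∀ {x x′ y} → InΓ n x → InΓ n x′ → InΓ n y →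
                   (x ⊕ x′) ⋆ y ∼ (x ⋆ y) ⊕ (x′ ⋆ y)
      ⋆-distribˡ : ∀ {x y y′} → InΓ n x → InΓ n y → InΓ n y′ →
                   x ⋆ (y ⊕ y′) ∼ (x ⋆ y) ⊕ (x ⋆ y′)
      ⋆-⊙ˡ       : ∀ α {x y} → InΓ n x → InΓ n y → (α ⊙ x) ⋆ y ∼ α ⊙ (x ⋆ y)
      ⋆-⊙ʳ       : ∀ α {x y} → InΓ n x → InΓ n y → x ⋆ (α ⊙ y) ∼ α ⊙ (x ⋆ y)
      ⋆-dp       : ∀ u v → [ u ]^[ n ] ⋆ [ v ]^[ n ] ∼ [ u * v ]^[ n ]

  data Generated {n : ℕ} (μ : GammaMult n) {s} (S : Tm → Set s)
       : Tm → Set (c ⊔ ℓ ⊔ a ⊔ ℓa ⊔ s) where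
    g-gen  : ∀ {x} → S x → Generated μ S x
    g-unit : Generated μ S [ 1# ]^[ n ]
    g-⊕    : ∀ {x y} → Generated μ S x → Generated μ S y → Generated μ S (x ⊕ y)
    g-⊙    : ∀ α {x} → Generated μ S x → Generated μ S (α ⊙ x)
    g-⋆    : ∀ {x y} → Generated μ S x → Generated μ S y →
             Generated μ S (GammaMult._⋆_ μ x y)
    g-∼    : ∀ {x y} → x ∼ y → Generated μ S x → Generated μ S y

  -- the element 1^{[n-1]} × υ^{[1]} of Γ^n_K(R)   (it is 0 for n = 0,
  -- since 1^{[-1]} = 0)
  oneTimes : ℕ → Carrier → Tm
  oneTimes zero    υ = 𝟘
  oneTimes (suc k) υ = [ 1# ]^[ k ] ⊗ [ υ ]^[ 1 ]

  MonoGens : ∀ {ι} {I : Set ι} → (I → Carrier) → ℕ → Tm → Set (c ⊔ a ⊔ ι)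
  MonoGens {I = I} r n x = Σ (List⁺ I) λ w → x ≡ oneTimes n (monomial A r w)

  MonoGensBounded : ∀ {ι} {I : Set ι} → (I → Carrier) → ℕ → Tm → Set (c ⊔ a ⊔ ι)
  MonoGensBounded {I = I} r n x =
    Σ (List⁺ I) λ w → (length w ≤ n) × (x ≡ oneTimes n (monomial A r w))

-- Write ψ m [x₁, …, x_k] = x₁^{[1]} × ⋯ × x_k^{[1]} × 1^{[m-k]} (zero when k > m), so that
-- 1^{[n-1]} × υ^{[1]} = ψ n [υ]. As i! m^{[i]} = (m^{[1]})^i and n! is invertible, Γ^n is spanned
-- by the ψ n [x₁, …, x_n]. Since x₁^{[1]} × ⋯ × x_n^{[1]} is the n-th finite difference of z ↦ z^{[n]},
-- polarising a^{[n]} ⋆ b^{[n]} = (ab)^{[n]} yields the product formula, for k ≤ n,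
--   ψ n [b] ⋆ ψ n [x₁, …, x_k] = ψ n [b, x₁, …, x_k] + Σᵢ ψ n [x₁, …, b xᵢ, …, x_k],
-- so by induction on k every ψ n [x₁, …, x_k] lies in the subalgebra generated by the ψ n [x];
-- these are linear in x, hence monomials x suffice.
-- When R is commutative and υ is a word of length > n, split υ into j + 1 ≤ n + 1 subwords: by the
-- product formula their ψ is (-1)^j j! ψ n [υ] modulo the subalgebra generated by shorter words. For
-- j = n the left-hand side vanishes, and n! is invertible.

module Submission where

open import Defs
open import Level using (_⊔_)
open import Algebra.Bundles using (CommutativeRing; CommutativeMonoid)
open import Algebra.Structures using (IsCommutativeRing)
import Algebra.Consequences.Setoid as Consequences
import Algebra.Properties.CommutativeSemigroup as CommutativeSemigroupProperties
import Algebra.Properties.Ring as RingProperties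
import Algebra.Properties.Semiring.Mult.TCOptimised as Multiples
open import Algebra.Solver.Ring.AlmostCommutativeRing using (fromCommutativeRing; _-Raw-AlmostCommutative⟶_)
open import Data.Integer.Base as ℤ using (ℤ; +_; -[1+_]; _⊖_; sign; ∣_∣; _◃_)
import Data.Integer.Properties as ℤ
open import Data.List.Base using (List; []; _∷_; _++_; map; replicate; length; foldr)
import Data.List.Properties as List
open import Data.List.NonEmpty.Base as List⁺ using (List⁺; _∷_; _⁺++⁺_)
import Data.List.NonEmpty.Properties as List⁺
open import Data.List.Relation.Unary.All as All using (All; []; _∷_)
import Data.List.Relation.Unary.All.Properties as All
open import Data.Maybe.Base as Maybe using (Maybe)
open import Data.Nat.Base as ℕ using (ℕ; zero; suc; _∸_; _!; z≤n; s≤s; z<s; s<s)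
import Data.Nat.Properties as ℕ
open import Data.Nat.Combinatorics using (_C_; nC1≡n; k![n∸k]!∣n!)
open import Data.Nat.Divisibility using (divides; m≤n⇒m!∣n!)
open import Data.Product.Base using (Σ; _×_; _,_)
open import Data.Sign.Base as Sign using (Sign)
open import Function.Base using (_∘_; id)
open import Relation.Binary.Bundles using (Setoid)
open import Relation.Binary.Consequences using (dec⇒weaklyDec)
open import Relation.Binary.Core using (_Preserves_⟶_)
open import Relation.Binary.PropositionalEquality using (_≡_)
import Relation.Binary.PropositionalEquality as ≡
import Relation.Binary.Reasoning.Setoid as SetoidReasoning
open import Relation.Nullary using (yes; no)

replaceEach : ∀ {b} {B : Set b} → (B → B) → List B → List (List B)
replaceEach f []       = []
replaceEach f (x ∷ xs) = (f x ∷ xs) ∷ map (x ∷_) (replaceEach f xs)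

module _ {b} {B : Set b} (f : B → B) where

  length-replaceEach : ∀ xs → length (replaceEach f xs) ≡ length xs
  length-replaceEach []       = ≡.refl
  length-replaceEach (x ∷ xs) = ≡.cong suc (≡.trans (List.length-map (x ∷_) (replaceEach f xs)) (length-replaceEach xs))

  length-∈replaceEach : ∀ xs → All (λ zs → length zs ≡ length xs) (replaceEach f xs)
  length-∈replaceEach []       = []
  length-∈replaceEach (x ∷ xs) = ≡.refl ∷ All.map⁺ (All.map (≡.cong suc) (length-∈replaceEach xs))

module _ {m ℓm} (M : CommutativeMonoid m ℓm) where
  open CommutativeMonoid M
  open CommutativeSemigroupProperties commutativeSemigroup using (x∙yz≈y∙xz)

  fold : ∀ {b} {B : Set b} → (B → Carrier) → List B → Carrier
  fold g = foldr (λ x acc → g x ∙ acc) ε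

  fold-∈replaceEach : ∀ {b} {B : Set b} {f : B → B} {g : B → Carrier} c → (∀ x → g (f x) ≈ c ∙ g x) →
                     ∀ xs → All (λ zs → fold g zs ≈ c ∙ fold g xs) (replaceEach f xs)
  fold-∈replaceEach c gf≈cg []       = []
  fold-∈replaceEach {g = g} c gf≈cg (x ∷ xs) =
    trans (∙-congʳ (gf≈cg x)) (assoc _ _ _) ∷
    All.map⁺ (All.map (λ eq → trans (∙-congˡ eq) (x∙yz≈y∙xz (g x) c _)) (fold-∈replaceEach c gf≈cg xs))

module _ {c ℓ a ℓa} (K : CommutativeRing c ℓ) (A : KAlgebra K a ℓa) where

  open Divided K A
  private
    module K = CommutativeRing K
    module A = KAlgebra A
  open KAlgebra A using (_·_)
    renaming (Carrier to R; _≈_ to _≈ᴿ_; _+_ to _+ᴿ_; _*_ to _*ᴿ_; 0# to 0ᴿ; 1# to 1ᴿ)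

  ∼-setoid : Setoid (c ⊔ a) (c ⊔ ℓ ⊔ a ⊔ ℓa)
  ∼-setoid = record
    { Carrier = Tm ; _≈_ = _∼_
    ; isEquivalence = record { refl = ∼-refl ; sym = ∼-sym ; trans = ∼-trans } }

  ∼-reflexive : ∀ {x y} → x ≡ y → x ∼ y
  ∼-reflexive = Setoid.reflexive ∼-setoid

  open SetoidReasoning ∼-setoid
  open Consequences ∼-setoid using (comm∧idˡ⇒id; comm∧invˡ⇒inv; comm∧distrˡ⇒distr)

  tm-isCommutativeRing : IsCommutativeRing _∼_ _⊕_ _⊗_ ⊖_ 𝟘 𝟙
  tm-isCommutativeRing = record
    { isRing = record
      { +-isAbelianGroup = record
        { isGroup = record
          { isMonoid = record
            { isSemigroup = record
              { isMagma = record { isEquivalence = Setoid.isEquivalence ∼-setoid ; ∙-cong = ⊕-cong }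
              ; assoc = ⊕-assoc }
            ; identity = comm∧idˡ⇒id ⊕-comm ⊕-idˡ }
          ; inverse = comm∧invˡ⇒inv ⊕-comm ⊖-invˡ
          ; ⁻¹-cong = ⊖-cong }
        ; comm = ⊕-comm }
      ; *-cong = ⊗-cong
      ; *-assoc = ⊗-assoc
      ; *-identity = comm∧idˡ⇒id ⊗-comm ⊗-idˡ
      ; distrib = comm∧distrˡ⇒distr ⊕-cong ⊗-comm ⊗-distribˡ }
    ; *-comm = ⊗-comm }

  tmRing : CommutativeRing (c ⊔ a) (c ⊔ ℓ ⊔ a ⊔ ℓa)
  tmRing = record { isCommutativeRing = tm-isCommutativeRing }

  open CommutativeRing tmRing using (ring; semiring; +-identityʳ; *-identityʳ; -‿inverseʳ; zeroˡ; zeroʳ; +-commutativeSemigroup)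
  open CommutativeSemigroupProperties +-commutativeSemigroup using (interchange)
  open RingProperties ring
    using (-‿distribˡ-*; -‿distribʳ-*; -‿involutive; -0#≈0#; -‿+-comm; x+x≈x⇒x≈0; +-inverseˡ-unique)
  open Multiples semiring using (×-homo-+; ×1-homo-*; 1+×) renaming (_×_ to _×ₙ_)

  ⟪_⟫ : ℕ → Tm
  ⟪ m ⟫ = m ×ₙ 𝟙

  ⟪⟫-suc : ∀ m → ⟪ suc m ⟫ ∼ 𝟙 ⊕ ⟪ m ⟫
  ⟪⟫-suc m = 1+× m 𝟙

  ⟪⟫-* : ∀ m n → ⟪ m ℕ.* n ⟫ ∼ ⟪ m ⟫ ⊗ ⟪ n ⟫
  ⟪⟫-* = ×1-homo-*

  ⟦_⟧ᶻ : ℤ → Tm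
  ⟦ + m ⟧ᶻ      = ⟪ m ⟫
  ⟦ -[1+ m ] ⟧ᶻ = ⊖ ⟪ suc m ⟫

  ⟦⟧ᶻ-⊖ : ∀ m n → ⟦ m ⊖ n ⟧ᶻ ∼ ⟪ m ⟫ ⊕ ⊖ ⟪ n ⟫
  ⟦⟧ᶻ-⊖ m       zero    = ∼-sym (∼-trans (⊕-cong ∼-refl -0#≈0#) (+-identityʳ _))
  ⟦⟧ᶻ-⊖ zero    (suc n) = ∼-sym (⊕-idˡ _)
  ⟦⟧ᶻ-⊖ (suc m) (suc n) rewrite ℤ.[1+m]⊖[1+n]≡m⊖n m n = begin
    ⟦ m ⊖ n ⟧ᶻ                          ≈⟨ ⟦⟧ᶻ-⊖ m n ⟩
    ⟪ m ⟫ ⊕ ⊖ ⟪ n ⟫                      ≈⟨ ⊕-idˡ _ ⟨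
    𝟘 ⊕ (⟪ m ⟫ ⊕ ⊖ ⟪ n ⟫)                ≈⟨ ⊕-cong (-‿inverseʳ 𝟙) ∼-refl ⟨
    (𝟙 ⊕ ⊖ 𝟙) ⊕ (⟪ m ⟫ ⊕ ⊖ ⟪ n ⟫)        ≈⟨ interchange 𝟙 (⊖ 𝟙) ⟪ m ⟫ (⊖ ⟪ n ⟫) ⟩
    (𝟙 ⊕ ⟪ m ⟫) ⊕ (⊖ 𝟙 ⊕ ⊖ ⟪ n ⟫)        ≈⟨ ⊕-cong (⟪⟫-suc m) (∼-trans (⊖-cong (⟪⟫-suc n)) (∼-sym (-‿+-comm 𝟙 ⟪ n ⟫))) ⟨
    ⟪ suc m ⟫ ⊕ ⊖ ⟪ suc n ⟫              ∎

  ⟦⟧ᶻ-+ : ∀ i j → ⟦ i ℤ.+ j ⟧ᶻ ∼ ⟦ i ⟧ᶻ ⊕ ⟦ j ⟧ᶻ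
  ⟦⟧ᶻ-+ (+ m)    (+ n)    = ×-homo-+ 𝟙 m n
  ⟦⟧ᶻ-+ (+ m)    -[1+ n ] = ⟦⟧ᶻ-⊖ m (suc n)
  ⟦⟧ᶻ-+ -[1+ m ] (+ n)    = ∼-trans (⟦⟧ᶻ-⊖ n (suc m)) (⊕-comm _ _)
  ⟦⟧ᶻ-+ -[1+ m ] -[1+ n ] = ∼-trans
    (⊖-cong (∼-trans (∼-reflexive (≡.cong ⟪_⟫ (≡.sym (ℕ.+-suc (suc m) n)))) (×-homo-+ 𝟙 (suc m) (suc n))))
    (∼-sym (-‿+-comm _ _))

  ⟦⟧ᶻ-neg : ∀ i → ⟦ ℤ.- i ⟧ᶻ ∼ ⊖ ⟦ i ⟧ᶻ
  ⟦⟧ᶻ-neg (+ zero)  = ∼-sym -0#≈0#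
  ⟦⟧ᶻ-neg (+ suc m) = ∼-refl
  ⟦⟧ᶻ-neg -[1+ m ]  = ∼-sym (-‿involutive _)

  private
    signed : Sign → Tm → Tm
    signed Sign.+ x = x
    signed Sign.- x = ⊖ x

    ⟦⟧ᶻ-◃ : ∀ s m → ⟦ s ◃ m ⟧ᶻ ∼ signed s ⟪ m ⟫
    ⟦⟧ᶻ-◃ Sign.+ zero    = ∼-refl
    ⟦⟧ᶻ-◃ Sign.- zero    = ∼-sym -0#≈0#
    ⟦⟧ᶻ-◃ Sign.+ (suc m) = ∼-refl
    ⟦⟧ᶻ-◃ Sign.- (suc m) = ∼-refl

    ⟦⟧ᶻ-sign : ∀ i → ⟦ i ⟧ᶻ ∼ signed (sign i) ⟪ ∣ i ∣ ⟫
    ⟦⟧ᶻ-sign (+ m)    = ∼-refl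
    ⟦⟧ᶻ-sign -[1+ m ] = ∼-refl

    signed-⊗ : ∀ s t x y → signed (s Sign.* t) (x ⊗ y) ∼ signed s x ⊗ signed t y
    signed-⊗ Sign.+ Sign.+ x y = ∼-refl
    signed-⊗ Sign.+ Sign.- x y = -‿distribʳ-* x y
    signed-⊗ Sign.- Sign.+ x y = -‿distribˡ-* x y
    signed-⊗ Sign.- Sign.- x y = begin
      x ⊗ y           ≈⟨ -‿involutive _ ⟨
      ⊖ ⊖ (x ⊗ y)     ≈⟨ ⊖-cong (-‿distribˡ-* x y) ⟩
      ⊖ (⊖ x ⊗ y)     ≈⟨ -‿distribʳ-* (⊖ x) y ⟩
      ⊖ x ⊗ ⊖ y       ∎

    signed-cong : ∀ s {x y} → x ∼ y → signed s x ∼ signed s y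
    signed-cong Sign.+ p = p
    signed-cong Sign.- p = ⊖-cong p

  ⟦⟧ᶻ-* : ∀ i j → ⟦ i ℤ.* j ⟧ᶻ ∼ ⟦ i ⟧ᶻ ⊗ ⟦ j ⟧ᶻ
  ⟦⟧ᶻ-* i j = begin
    ⟦ s ◃ (∣ i ∣ ℕ.* ∣ j ∣) ⟧ᶻ                      ≈⟨ ⟦⟧ᶻ-◃ s (∣ i ∣ ℕ.* ∣ j ∣) ⟩
    signed s ⟪ ∣ i ∣ ℕ.* ∣ j ∣ ⟫                     ≈⟨ signed-cong s (⟪⟫-* ∣ i ∣ ∣ j ∣) ⟩
    signed s (⟪ ∣ i ∣ ⟫ ⊗ ⟪ ∣ j ∣ ⟫)                 ≈⟨ signed-⊗ (sign i) (sign j) _ _ ⟩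
    signed (sign i) ⟪ ∣ i ∣ ⟫ ⊗ signed (sign j) ⟪ ∣ j ∣ ⟫ ≈⟨ ⊗-cong (⟦⟧ᶻ-sign i) (⟦⟧ᶻ-sign j) ⟨
    ⟦ i ⟧ᶻ ⊗ ⟦ j ⟧ᶻ                                  ∎
    where s = sign i Sign.* sign j

  ℤ⟶tm : CommutativeRing.rawRing ℤ.+-*-commutativeRing -Raw-AlmostCommutative⟶ fromCommutativeRing tmRing
  ℤ⟶tm = record
    { ⟦_⟧ = ⟦_⟧ᶻ ; +-homo = ⟦⟧ᶻ-+ ; *-homo = ⟦⟧ᶻ-* ; -‿homo = ⟦⟧ᶻ-neg
    ; 0-homo = ∼-refl ; 1-homo = ∼-refl }

  ⟦⟧ᶻ-≟ : ∀ i j → Maybe (⟦ i ⟧ᶻ ∼ ⟦ j ⟧ᶻ)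
  ⟦⟧ᶻ-≟ i j = Maybe.map (∼-reflexive ∘ ≡.cong ⟦_⟧ᶻ) (dec⇒weaklyDec ℤ._≟_ i j)

  open import Algebra.Solver.Ring (CommutativeRing.rawRing ℤ.+-*-commutativeRing) (fromCommutativeRing tmRing) ℤ⟶tm ⟦⟧ᶻ-≟
    using (solve; _:=_; _:+_; _:*_; :-_; _:-_; con)

  scalar : K.Carrier → Tm
  scalar α = α ⊙ 𝟙

  ⊙≈scalar⊗ : ∀ α x → α ⊙ x ∼ scalar α ⊗ x
  ⊙≈scalar⊗ α x = ∼-trans (⊙-cong K.refl (∼-sym (⊗-idˡ x))) (⊙-⊗ α 𝟙 x)

  scalar-cong : ∀ {α β} → α K.≈ β → scalar α ∼ scalar β
  scalar-cong α≈β = ⊙-cong α≈β ∼-refl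

  scalar-* : ∀ α β → scalar (α K.* β) ∼ scalar α ⊗ scalar β
  scalar-* α β = ∼-trans (⊙-assoc α β 𝟙) (⊙≈scalar⊗ α (scalar β))

  scalar-0 : scalar K.0# ∼ 𝟘
  scalar-0 = x+x≈x⇒x≈0 _ (∼-trans (∼-sym (⊙-distribʳ K.0# K.0# 𝟙)) (scalar-cong (K.+-identityˡ K.0#)))

  scalar-neg : ∀ α → scalar (K.- α) ∼ ⊖ scalar α
  scalar-neg α = +-inverseˡ-unique _ _ (∼-trans (∼-sym (⊙-distribʳ (K.- α) α 𝟙)) (∼-trans (scalar-cong (K.-‿inverseˡ α)) scalar-0))

  scalar-fromℕ : ∀ m → scalar (fromℕ K m) ∼ ⟪ m ⟫
  scalar-fromℕ zero    = scalar-0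
  scalar-fromℕ (suc m) = begin
    scalar (K.1# K.+ fromℕ K m)   ≈⟨ ⊙-distribʳ K.1# (fromℕ K m) 𝟙 ⟩
    scalar K.1# ⊕ scalar (fromℕ K m) ≈⟨ ⊕-cong (⊙-identity 𝟙) (scalar-fromℕ m) ⟩
    𝟙 ⊕ ⟪ m ⟫                     ≈⟨ ⟪⟫-suc m ⟨
    ⟪ suc m ⟫                     ∎

  0⊙ : ∀ x → K.0# ⊙ x ∼ 𝟘
  0⊙ x = ∼-trans (⊙≈scalar⊗ K.0# x) (∼-trans (⊗-cong scalar-0 ∼-refl) (zeroˡ x))

  -1⊙ : ∀ x → (K.- K.1#) ⊙ x ∼ ⊖ x
  -1⊙ x = ∼-trans (⊙≈scalar⊗ _ x) (∼-trans (⊗-cong (∼-trans (scalar-neg K.1#) (⊖-cong (⊙-identity 𝟙))) ∼-refl)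
            (∼-trans (∼-sym (-‿distribˡ-* 𝟙 x)) (⊖-cong (⊗-idˡ x))))

  fromℕ⊙ : ∀ m x → fromℕ K m ⊙ x ∼ ⟪ m ⟫ ⊗ x
  fromℕ⊙ m x = ∼-trans (⊙≈scalar⊗ _ x) (⊗-cong (scalar-fromℕ m) ∼-refl)

  ⊗-⊙ʳ : ∀ α x y → x ⊗ (α ⊙ y) ∼ α ⊙ (x ⊗ y)
  ⊗-⊙ʳ α x y = begin
    x ⊗ (α ⊙ y)          ≈⟨ ⊗-cong ∼-refl (⊙≈scalar⊗ α y) ⟩
    x ⊗ (scalar α ⊗ y)   ≈⟨ solve 3 (λ x s y → x :* (s :* y) := s :* (x :* y)) ∼-refl x (scalar α) y ⟩
    scalar α ⊗ (x ⊗ y)   ≈⟨ ⊙≈scalar⊗ α _ ⟨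
    α ⊙ (x ⊗ y)          ∎

  !-inverse : ∀ {n j} → FactorialInvertible K n → j ℕ.≤ n →
              Σ K.Carrier λ β → ∀ x → β ⊙ (⟪ j ! ⟫ ⊗ x) ∼ x
  !-inverse {n} {j} (u , u*n!≈1) j≤n with m≤n⇒m!∣n! j≤n
  ... | divides q n!≡q*j! = u K.* fromℕ K q , λ x → begin
    (u K.* fromℕ K q) ⊙ (⟪ j ! ⟫ ⊗ x)              ≈⟨ ⊙≈scalar⊗ _ _ ⟩
    scalar (u K.* fromℕ K q) ⊗ (⟪ j ! ⟫ ⊗ x)       ≈⟨ ⊗-cong (∼-trans (scalar-* u _) (⊗-cong ∼-refl (scalar-fromℕ q))) ∼-refl ⟩
    (scalar u ⊗ ⟪ q ⟫) ⊗ (⟪ j ! ⟫ ⊗ x)             ≈⟨ solve 4 (λ s q f x → (s :* q) :* (f :* x) := (s :* (q :* f)) :* x) ∼-refl _ _ _ _ ⟩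
    (scalar u ⊗ (⟪ q ⟫ ⊗ ⟪ j ! ⟫)) ⊗ x             ≈⟨ ⊗-cong (⊗-cong ∼-refl (∼-sym (⟪⟫-* q (j !)))) ∼-refl ⟩
    (scalar u ⊗ ⟪ q ℕ.* j ! ⟫) ⊗ x                 ≡⟨ ≡.cong (λ m → (scalar u ⊗ ⟪ m ⟫) ⊗ x) n!≡q*j! ⟨
    (scalar u ⊗ ⟪ n ! ⟫) ⊗ x                       ≈⟨ ⊗-cong (∼-trans (⊗-cong ∼-refl (∼-sym (scalar-fromℕ (n !)))) (∼-sym (scalar-* u _))) ∼-refl ⟩
    scalar (u K.* fromℕ K (n !)) ⊗ x               ≈⟨ ⊗-cong (∼-trans (scalar-cong u*n!≈1) (⊙-identity 𝟙)) ∼-refl ⟩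
    𝟙 ⊗ x                                          ≈⟨ ⊗-idˡ x ⟩
    x                                              ∎

  !-cancel : ∀ {n j x y} → FactorialInvertible K n → j ℕ.≤ n → ⟪ j ! ⟫ ⊗ x ∼ ⟪ j ! ⟫ ⊗ y → x ∼ y
  !-cancel n!⁻¹ j≤n eq with !-inverse n!⁻¹ j≤n
  ... | β , inv = ∼-trans (∼-sym (inv _)) (∼-trans (⊙-cong K.refl eq) (inv _))

  dp¹-+ : ∀ x y → [ x +ᴿ y ]^[ 1 ] ∼ [ x ]^[ 1 ] ⊕ [ y ]^[ 1 ]
  dp¹-+ x y = begin
    [ x +ᴿ y ]^[ 1 ]                                               ≈⟨ dp-add x y 1 ⟩
    [ x ]^[ 0 ] ⊗ [ y ]^[ 1 ] ⊕ [ x ]^[ 1 ] ⊗ [ y ]^[ 0 ]          ≈⟨ ⊕-cong (⊗-cong (dp-zero x) ∼-refl) (⊗-cong ∼-refl (dp-zero y)) ⟩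
    𝟙 ⊗ [ y ]^[ 1 ] ⊕ [ x ]^[ 1 ] ⊗ 𝟙                              ≈⟨ solve 2 (λ X Y → con (+ 1) :* Y :+ X :* con (+ 1) := X :+ Y) ∼-refl _ _ ⟩
    [ x ]^[ 1 ] ⊕ [ y ]^[ 1 ]                                      ∎

  dp¹-· : ∀ α x → [ α · x ]^[ 1 ] ∼ α ⊙ [ x ]^[ 1 ]
  dp¹-· α x = ∼-trans (dp-scal α x 1) (⊙-cong (K.*-identityʳ α) ∼-refl)

  dp¹⊗dp : ∀ x j → [ x ]^[ 1 ] ⊗ [ x ]^[ j ] ∼ ⟪ suc j ⟫ ⊗ [ x ]^[ suc j ]
  dp¹⊗dp x j = begin
    [ x ]^[ 1 ] ⊗ [ x ]^[ j ]                    ≈⟨ dp-mul x 1 j ⟩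
    fromℕ K (suc j C 1) ⊙ [ x ]^[ suc j ]        ≡⟨ ≡.cong (λ m → fromℕ K m ⊙ [ x ]^[ suc j ]) (nC1≡n (suc j)) ⟩
    fromℕ K (suc j) ⊙ [ x ]^[ suc j ]            ≈⟨ fromℕ⊙ (suc j) _ ⟩
    ⟪ suc j ⟫ ⊗ [ x ]^[ suc j ]                  ∎

  prod¹ : List R → Tm
  prod¹ []       = 𝟙
  prod¹ (x ∷ xs) = [ x ]^[ 1 ] ⊗ prod¹ xs

  prod¹-++ : ∀ xs ys → prod¹ (xs ++ ys) ∼ prod¹ xs ⊗ prod¹ ys
  prod¹-++ []       ys = ∼-sym (⊗-idˡ _)
  prod¹-++ (x ∷ xs) ys = ∼-trans (⊗-cong ∼-refl (prod¹-++ xs ys)) (∼-sym (⊗-assoc _ _ _))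

  prod¹-replicate : ∀ j x → prod¹ (replicate j x) ∼ ⟪ j ! ⟫ ⊗ [ x ]^[ j ]
  prod¹-replicate zero    x = ∼-trans (∼-sym (dp-zero x)) (∼-sym (⊗-idˡ _))
  prod¹-replicate (suc j) x = begin
    [ x ]^[ 1 ] ⊗ prod¹ (replicate j x)            ≈⟨ ⊗-cong ∼-refl (prod¹-replicate j x) ⟩
    [ x ]^[ 1 ] ⊗ (⟪ j ! ⟫ ⊗ [ x ]^[ j ])          ≈⟨ solve 3 (λ a b c → a :* (b :* c) := b :* (a :* c)) ∼-refl _ _ _ ⟩
    ⟪ j ! ⟫ ⊗ ([ x ]^[ 1 ] ⊗ [ x ]^[ j ])          ≈⟨ ⊗-cong ∼-refl (dp¹⊗dp x j) ⟩
    ⟪ j ! ⟫ ⊗ (⟪ suc j ⟫ ⊗ [ x ]^[ suc j ])        ≈⟨ solve 3 (λ a b c → a :* (b :* c) := (b :* a) :* c) ∼-refl _ _ _ ⟩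
    (⟪ suc j ⟫ ⊗ ⟪ j ! ⟫) ⊗ [ x ]^[ suc j ]        ≈⟨ ⊗-cong (⟪⟫-* (suc j) (j !)) ∼-refl ⟨
    ⟪ suc j ! ⟫ ⊗ [ x ]^[ suc j ]                  ∎

  -- Finite sums and finite differences

  ∑ : ℕ → (ℕ → Tm) → Tm
  ∑ zero    f = 𝟘
  ∑ (suc m) f = f 0 ⊕ ∑ m (f ∘ suc)

  syntax ∑ m (λ i → t) = ∑[ i < m ] t

  ∑-cong : ∀ m {f g} → (∀ i → f i ∼ g i) → ∑ m f ∼ ∑ m g
  ∑-cong zero    f∼g = ∼-refl
  ∑-cong (suc m) f∼g = ⊕-cong (f∼g 0) (∑-cong m (f∼g ∘ suc))

  ∑-⊗ : ∀ m c f → c ⊗ ∑ m f ∼ ∑[ i < m ] (c ⊗ f i)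
  ∑-⊗ zero    c f = zeroʳ c
  ∑-⊗ (suc m) c f = ∼-trans (⊗-distribˡ _ _ _) (⊕-cong ∼-refl (∑-⊗ m c (f ∘ suc)))

  ∑-𝟘 : ∀ m {f} → (∀ i → i ℕ.< m → f i ∼ 𝟘) → ∑ m f ∼ 𝟘
  ∑-𝟘 zero    f∼0 = ∼-refl
  ∑-𝟘 (suc m) f∼0 = ∼-trans (⊕-cong (f∼0 0 z<s) (∑-𝟘 m (λ i i<m → f∼0 (suc i) (s<s i<m)))) (⊕-idˡ 𝟘)

  ∑-snoc : ∀ m f → ∑ (suc m) f ∼ ∑ m f ⊕ f m
  ∑-snoc zero    f = ⊕-comm _ _
  ∑-snoc (suc m) f = ∼-trans (⊕-cong ∼-refl (∑-snoc m (f ∘ suc))) (∼-sym (⊕-assoc _ _ _))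

  ∑-head : ∀ m f → (∀ i → i ℕ.< m → f (suc i) ∼ 𝟘) → ∑ (suc m) f ∼ f 0
  ∑-head m f tail∼0 = ∼-trans (⊕-cong ∼-refl (∑-𝟘 m tail∼0)) (+-identityʳ _)

  private
    ∸-suc-< : ∀ {m i} → i ℕ.< m → m ∸ suc i ℕ.< m
    ∸-suc-< i<m = ℕ.∸-monoʳ-< z<s i<m

  sumTo≈∑ : ∀ f k → sumTo f k ∼ ∑ (suc k) f
  sumTo≈∑ f zero    = ∼-sym (+-identityʳ _)
  sumTo≈∑ f (suc k) = ∼-trans (⊕-cong (sumTo≈∑ f k) ∼-refl) (∼-sym (∑-snoc (suc k) f))

  dp-binomial : ∀ m x z → [ z +ᴿ x ]^[ m ] ∼ ∑[ i < suc m ] ([ x ]^[ i ] ⊗ [ z ]^[ m ∸ i ])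
  dp-binomial m x z = ∼-trans (gen-cong m (A.+-comm z x)) (∼-trans (dp-add x z m) (sumTo≈∑ _ m))

  Δ : List R → (R → Tm) → R → Tm
  Δ []       f z = f z
  Δ (x ∷ xs) f z = Δ xs f (z +ᴿ x) ⊕ ⊖ Δ xs f z

  Δ-preserves : ∀ xs {f} → f Preserves _≈ᴿ_ ⟶ _∼_ → Δ xs f Preserves _≈ᴿ_ ⟶ _∼_
  Δ-preserves []       resp z≈z′ = resp z≈z′
  Δ-preserves (x ∷ xs) resp z≈z′ =
    ⊕-cong (Δ-preserves xs resp (A.+-cong z≈z′ A.refl)) (⊖-cong (Δ-preserves xs resp z≈z′))

  Δ-cong : ∀ xs {f g} → (∀ z → f z ∼ g z) → ∀ z → Δ xs f z ∼ Δ xs g z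
  Δ-cong []       f∼g z = f∼g z
  Δ-cong (x ∷ xs) f∼g z = ⊕-cong (Δ-cong xs f∼g (z +ᴿ x)) (⊖-cong (Δ-cong xs f∼g z))

  Δ-translate : ∀ xs {f} → f Preserves _≈ᴿ_ ⟶ _∼_ → ∀ x z → Δ xs f (z +ᴿ x) ∼ Δ xs (λ z → f (z +ᴿ x)) z
  Δ-translate []       resp x z = ∼-refl
  Δ-translate (y ∷ ys) resp x z = ⊕-cong
    (∼-trans (Δ-preserves ys resp (swap z x y)) (Δ-translate ys resp x (z +ᴿ y)))
    (⊖-cong (Δ-translate ys resp x z))
    where
    swap : ∀ z x y → (z +ᴿ x) +ᴿ y ≈ᴿ (z +ᴿ y) +ᴿ x
    swap z x y = A.trans (A.+-assoc z x y) (A.trans (A.+-cong A.refl (A.+-comm x y)) (A.sym (A.+-assoc z y x)))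

  Δ-scale : ∀ xs {f} → f Preserves _≈ᴿ_ ⟶ _∼_ → ∀ s z → Δ xs (λ z → f (z *ᴿ s)) z ∼ Δ (map (_*ᴿ s) xs) f (z *ᴿ s)
  Δ-scale []       resp s z = ∼-refl
  Δ-scale (x ∷ xs) resp s z = ⊕-cong
    (∼-trans (Δ-scale xs resp s (z +ᴿ x)) (Δ-preserves (map (_*ᴿ s) xs) resp (A.distribʳ s z x)))
    (⊖-cong (Δ-scale xs resp s z))

  Δ-⊕ : ∀ xs f g z → Δ xs (λ z → f z ⊕ g z) z ∼ Δ xs f z ⊕ Δ xs g z
  Δ-⊕ []       f g z = ∼-refl
  Δ-⊕ (x ∷ xs) f g z = ∼-trans (⊕-cong (Δ-⊕ xs f g (z +ᴿ x)) (⊖-cong (Δ-⊕ xs f g z)))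
    (solve 4 (λ a b c d → (a :+ b) :- (c :+ d) := (a :- c) :+ (b :- d)) ∼-refl _ _ _ _)

  Δ-⊗ : ∀ xs c f z → Δ xs (λ z → c ⊗ f z) z ∼ c ⊗ Δ xs f z
  Δ-⊗ []       c f z = ∼-refl
  Δ-⊗ (x ∷ xs) c f z = ∼-trans (⊕-cong (Δ-⊗ xs c f (z +ᴿ x)) (⊖-cong (Δ-⊗ xs c f z)))
    (solve 3 (λ c a b → c :* a :- c :* b := c :* (a :- b)) ∼-refl _ _ _)

  Δ-∑ : ∀ xs m (c : ℕ → Tm) (f : ℕ → R → Tm) z →
        Δ xs (λ z → ∑[ i < m ] (c i ⊗ f i z)) z ∼ ∑[ i < m ] (c i ⊗ Δ xs (f i) z)
  Δ-∑ xs zero    c f z = Δ-𝟘 xs z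
    where
    Δ-𝟘 : ∀ xs z → Δ xs (λ _ → 𝟘) z ∼ 𝟘
    Δ-𝟘 []       z = ∼-refl
    Δ-𝟘 (x ∷ xs) z = ∼-trans (⊕-cong (Δ-𝟘 xs _) (⊖-cong (Δ-𝟘 xs z))) (-‿inverseʳ 𝟘)
  Δ-∑ xs (suc m) c f z =
    ∼-trans (Δ-⊕ xs (λ z → c 0 ⊗ f 0 z) (λ z → ∑[ i < m ] (c (suc i) ⊗ f (suc i) z)) z)
      (⊕-cong (Δ-⊗ xs (c 0) (f 0) z) (Δ-∑ xs m (c ∘ suc) (f ∘ suc) z))

  Δ-∷ : ∀ x xs f z {t} → Δ xs f (z +ᴿ x) ∼ Δ xs f z ⊕ t → Δ (x ∷ xs) f z ∼ t
  Δ-∷ x xs f z {t} eq = ∼-trans (⊕-cong eq ∼-refl) (solve 2 (λ a t → (a :+ t) :- a := t) ∼-refl _ _)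

  Δ-dp-translate : ∀ xs m x z → Δ xs [_]^[ m ] (z +ᴿ x) ∼ ∑[ i < suc m ] ([ x ]^[ i ] ⊗ Δ xs [_]^[ m ∸ i ] z)
  Δ-dp-translate xs m x z = begin
    Δ xs [_]^[ m ] (z +ᴿ x)                                   ≈⟨ Δ-translate xs (gen-cong m) x z ⟩
    Δ xs (λ z → [ z +ᴿ x ]^[ m ]) z                           ≈⟨ Δ-cong xs (dp-binomial m x) z ⟩
    Δ xs (λ z → ∑[ i < suc m ] ([ x ]^[ i ] ⊗ [ z ]^[ m ∸ i ])) z ≈⟨ Δ-∑ xs (suc m) [ x ]^[_] (λ i → [_]^[ m ∸ i ]) z ⟩
    ∑[ i < suc m ] ([ x ]^[ i ] ⊗ Δ xs [_]^[ m ∸ i ] z)       ∎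

  Δ-dp-∷ : ∀ x xs m z → Δ (x ∷ xs) [_]^[ m ] z ∼ ∑[ i < m ] ([ x ]^[ suc i ] ⊗ Δ xs [_]^[ m ∸ suc i ] z)
  Δ-dp-∷ x xs m z = Δ-∷ x xs [_]^[ m ] z (∼-trans (Δ-dp-translate xs m x z)
    (⊕-cong (∼-trans (⊗-cong (dp-zero x) ∼-refl) (⊗-idˡ _)) ∼-refl))

  Δ-dp-vanish : ∀ xs m z → m ℕ.< length xs → Δ xs [_]^[ m ] z ∼ 𝟘
  Δ-dp-vanish (x ∷ xs) m z (s≤s m≤∣xs∣) = ∼-trans (Δ-dp-∷ x xs m z) (∑-𝟘 m λ i i<m →
    ∼-trans (⊗-cong ∼-refl (Δ-dp-vanish xs (m ∸ suc i) z (ℕ.<-≤-trans (∸-suc-< i<m) m≤∣xs∣))) (zeroʳ _))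

  Δ-dp-top : ∀ {m} xs z → length xs ≡ m → Δ xs [_]^[ m ] z ∼ prod¹ xs
  Δ-dp-top []       z ≡.refl = dp-zero z
  Δ-dp-top (x ∷ xs) z ≡.refl = begin
    Δ (x ∷ xs) [_]^[ suc (length xs) ] z                                      ≈⟨ Δ-dp-∷ x xs _ z ⟩
    ∑[ i < suc (length xs) ] ([ x ]^[ suc i ] ⊗ Δ xs [_]^[ length xs ∸ i ] z)
      ≈⟨ ∑-head (length xs) (λ i → [ x ]^[ suc i ] ⊗ Δ xs [_]^[ length xs ∸ i ] z) (λ i i<∣xs∣ →
           ∼-trans (⊗-cong ∼-refl (Δ-dp-vanish xs _ z (∸-suc-< i<∣xs∣))) (zeroʳ _)) ⟩
    [ x ]^[ 1 ] ⊗ Δ xs [_]^[ length xs ] z                                    ≈⟨ ⊗-cong ∼-refl (Δ-dp-top xs z ≡.refl) ⟩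
    prod¹ (x ∷ xs)                                                            ∎

  -- δdp b m z = δ_b (z^{[m+1]}) and δprod¹ b xs = δ_b (prod¹ xs) for the derivation δ_b : x^{[1]} ↦ (b x)^{[1]}.
  δdp : R → ℕ → R → Tm
  δdp b m z = [ b *ᴿ z ]^[ 1 ] ⊗ [ z ]^[ m ]

  δprod¹ : R → List R → Tm
  δprod¹ b []       = 𝟘
  δprod¹ b (x ∷ xs) = [ b *ᴿ x ]^[ 1 ] ⊗ prod¹ xs ⊕ [ x ]^[ 1 ] ⊗ δprod¹ b xs

  δdp-preserves : ∀ b m → δdp b m Preserves _≈ᴿ_ ⟶ _∼_
  δdp-preserves b m z≈z′ = ⊗-cong (gen-cong 1 (A.*-cong A.refl z≈z′)) (gen-cong m z≈z′)

  δdp-translate : ∀ b m x z →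
    δdp b m (z +ᴿ x) ∼ ∑[ i < suc m ] ([ x ]^[ i ] ⊗ δdp b (m ∸ i) z) ⊕ [ b *ᴿ x ]^[ 1 ] ⊗ [ z +ᴿ x ]^[ m ]
  δdp-translate b m x z = begin
    [ b *ᴿ (z +ᴿ x) ]^[ 1 ] ⊗ [ z +ᴿ x ]^[ m ]
      ≈⟨ ⊗-cong (∼-trans (gen-cong 1 (A.distribˡ b z x)) (dp¹-+ _ _)) ∼-refl ⟩
    ([ b *ᴿ z ]^[ 1 ] ⊕ [ b *ᴿ x ]^[ 1 ]) ⊗ [ z +ᴿ x ]^[ m ]
      ≈⟨ solve 3 (λ p q t → (p :+ q) :* t := p :* t :+ q :* t) ∼-refl _ _ _ ⟩
    [ b *ᴿ z ]^[ 1 ] ⊗ [ z +ᴿ x ]^[ m ] ⊕ [ b *ᴿ x ]^[ 1 ] ⊗ [ z +ᴿ x ]^[ m ]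
      ≈⟨ ⊕-cong (⊗-cong ∼-refl (dp-binomial m x z)) ∼-refl ⟩
    [ b *ᴿ z ]^[ 1 ] ⊗ ∑[ i < suc m ] ([ x ]^[ i ] ⊗ [ z ]^[ m ∸ i ]) ⊕ [ b *ᴿ x ]^[ 1 ] ⊗ [ z +ᴿ x ]^[ m ]
      ≈⟨ ⊕-cong (∼-trans (∑-⊗ (suc m) [ b *ᴿ z ]^[ 1 ] (λ i → [ x ]^[ i ] ⊗ [ z ]^[ m ∸ i ])) (∑-cong (suc m) λ i →
           solve 3 (λ p u v → p :* (u :* v) := u :* (p :* v)) ∼-refl [ b *ᴿ z ]^[ 1 ] [ x ]^[ i ] [ z ]^[ m ∸ i ])) ∼-refl ⟩
    ∑[ i < suc m ] ([ x ]^[ i ] ⊗ δdp b (m ∸ i) z) ⊕ [ b *ᴿ x ]^[ 1 ] ⊗ [ z +ᴿ x ]^[ m ]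
      ∎

  Δ-δdp-∷ : ∀ b x xs m z → Δ (x ∷ xs) (δdp b m) z ∼
    ∑[ i < m ] ([ x ]^[ suc i ] ⊗ Δ xs (δdp b (m ∸ suc i)) z) ⊕ [ b *ᴿ x ]^[ 1 ] ⊗ Δ xs [_]^[ m ] (z +ᴿ x)
  Δ-δdp-∷ b x xs m z = Δ-∷ x xs (δdp b m) z (begin
    Δ xs (δdp b m) (z +ᴿ x)
      ≈⟨ Δ-translate xs (δdp-preserves b m) x z ⟩
    Δ xs (λ z → δdp b m (z +ᴿ x)) z
      ≈⟨ Δ-cong xs (δdp-translate b m x) z ⟩
    Δ xs (λ z → ∑[ i < suc m ] ([ x ]^[ i ] ⊗ δdp b (m ∸ i) z) ⊕ bx ⊗ [ z +ᴿ x ]^[ m ]) z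
      ≈⟨ Δ-⊕ xs _ (λ z → bx ⊗ [ z +ᴿ x ]^[ m ]) z ⟩
    Δ xs (λ z → ∑[ i < suc m ] ([ x ]^[ i ] ⊗ δdp b (m ∸ i) z)) z ⊕ Δ xs (λ z → bx ⊗ [ z +ᴿ x ]^[ m ]) z
      ≈⟨ ⊕-cong (Δ-∑ xs (suc m) [ x ]^[_] (λ i → δdp b (m ∸ i)) z)
                (∼-trans (Δ-⊗ xs bx _ z) (⊗-cong ∼-refl (∼-sym (Δ-translate xs (gen-cong m) x z)))) ⟩
    ([ x ]^[ 0 ] ⊗ Δ xs (δdp b m) z ⊕ T) ⊕ bx ⊗ Δ xs [_]^[ m ] (z +ᴿ x)
      ≈⟨ ⊕-cong (⊕-cong (⊗-cong (dp-zero x) ∼-refl) ∼-refl) ∼-refl ⟩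
    (𝟙 ⊗ Δ xs (δdp b m) z ⊕ T) ⊕ bx ⊗ Δ xs [_]^[ m ] (z +ᴿ x)
      ≈⟨ solve 3 (λ a t u → (con (+ 1) :* a :+ t) :+ u := a :+ (t :+ u)) ∼-refl _ _ _ ⟩
    Δ xs (δdp b m) z ⊕ (T ⊕ bx ⊗ Δ xs [_]^[ m ] (z +ᴿ x))
      ∎)
    where
    bx = [ b *ᴿ x ]^[ 1 ]
    T = ∑[ i < m ] ([ x ]^[ suc i ] ⊗ Δ xs (δdp b (m ∸ suc i)) z)

  Δ-δdp-vanish : ∀ b xs m z → suc m ℕ.< length xs → Δ xs (δdp b m) z ∼ 𝟘
  Δ-δdp-vanish b (x ∷ xs) m z (s≤s m<∣xs∣) = begin
    Δ (x ∷ xs) (δdp b m) z                  ≈⟨ Δ-δdp-∷ b x xs m z ⟩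
    ∑[ i < m ] ([ x ]^[ suc i ] ⊗ Δ xs (δdp b (m ∸ suc i)) z) ⊕ [ b *ᴿ x ]^[ 1 ] ⊗ Δ xs [_]^[ m ] (z +ᴿ x)
      ≈⟨ ⊕-cong (∑-𝟘 m λ i i<m → ∼-trans (⊗-cong ∼-refl
                   (Δ-δdp-vanish b xs (m ∸ suc i) z (ℕ.≤-<-trans (∸-suc-< i<m) m<∣xs∣))) (zeroʳ _))
                (∼-trans (⊗-cong ∼-refl (Δ-dp-vanish xs m _ m<∣xs∣)) (zeroʳ _)) ⟩
    𝟘 ⊕ 𝟘                                   ≈⟨ ⊕-idˡ 𝟘 ⟩
    𝟘                                       ∎

  Δ-δdp-top : ∀ b {m} xs z → length xs ≡ suc m → Δ xs (δdp b m) z ∼ δprod¹ b xs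
  Δ-δdp-top b (x ∷ xs) z ≡.refl = begin
    Δ (x ∷ xs) (δdp b (length xs)) z
      ≈⟨ Δ-δdp-∷ b x xs (length xs) z ⟩
    ∑[ i < length xs ] ([ x ]^[ suc i ] ⊗ Δ xs (δdp b (length xs ∸ suc i)) z) ⊕ [ b *ᴿ x ]^[ 1 ] ⊗ Δ xs [_]^[ length xs ] (z +ᴿ x)
      ≈⟨ ⊕-cong (lower xs) (⊗-cong ∼-refl (Δ-dp-top xs _ ≡.refl)) ⟩
    [ x ]^[ 1 ] ⊗ δprod¹ b xs ⊕ [ b *ᴿ x ]^[ 1 ] ⊗ prod¹ xs
      ≈⟨ ⊕-comm _ _ ⟩
    δprod¹ b (x ∷ xs)
      ∎
    where
    lower : ∀ xs → ∑[ i < length xs ] ([ x ]^[ suc i ] ⊗ Δ xs (δdp b (length xs ∸ suc i)) z) ∼ [ x ]^[ 1 ] ⊗ δprod¹ b xs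
    lower []       = ∼-sym (zeroʳ _)
    lower (y ∷ ys) = ∼-trans
      (∑-head (length ys) (λ i → [ x ]^[ suc i ] ⊗ Δ (y ∷ ys) (δdp b (length ys ∸ i)) z) λ i i<∣ys∣ →
        ∼-trans (⊗-cong ∼-refl (Δ-δdp-vanish b (y ∷ ys) _ z (s<s (∸-suc-< i<∣ys∣)))) (zeroʳ _))
      (⊗-cong ∼-refl (Δ-δdp-top b (y ∷ ys) z ≡.refl))

  ∑ₗ : ∀ {b} {B : Set b} → (B → Tm) → List B → Tm
  ∑ₗ F []       = 𝟘
  ∑ₗ F (l ∷ ls) = F l ⊕ ∑ₗ F ls

  module _ {b} {B : Set b} where

    ∑ₗ-map : ∀ {b′} {B′ : Set b′} (F : B′ → Tm) (g : B → B′) ls → ∑ₗ F (map g ls) ≡ ∑ₗ (F ∘ g) ls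
    ∑ₗ-map F g []       = ≡.refl
    ∑ₗ-map F g (l ∷ ls) = ≡.cong (F (g l) ⊕_) (∑ₗ-map F g ls)

    ∑ₗ-cong : ∀ {F F′ : B → Tm} {ls} → All (λ l → F l ∼ F′ l) ls → ∑ₗ F ls ∼ ∑ₗ F′ ls
    ∑ₗ-cong []         = ∼-refl
    ∑ₗ-cong (eq ∷ eqs) = ⊕-cong eq (∑ₗ-cong eqs)

    ∑ₗ-𝟘 : ∀ {F : B → Tm} ls → (∀ l → F l ∼ 𝟘) → ∑ₗ F ls ∼ 𝟘
    ∑ₗ-𝟘 []       F∼0 = ∼-refl
    ∑ₗ-𝟘 (l ∷ ls) F∼0 = ∼-trans (⊕-cong (F∼0 l) (∑ₗ-𝟘 ls F∼0)) (⊕-idˡ 𝟘)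

    ∑ₗ-⊗ˡ : ∀ c (F : B → Tm) ls → ∑ₗ (λ l → c ⊗ F l) ls ∼ c ⊗ ∑ₗ F ls
    ∑ₗ-⊗ˡ c F []       = ∼-sym (zeroʳ c)
    ∑ₗ-⊗ˡ c F (l ∷ ls) = ∼-trans (⊕-cong ∼-refl (∑ₗ-⊗ˡ c F ls)) (∼-sym (⊗-distribˡ _ _ _))

    ∑ₗ-⊗ʳ : ∀ (F : B → Tm) ls c → ∑ₗ F ls ⊗ c ∼ ∑ₗ (λ l → F l ⊗ c) ls
    ∑ₗ-⊗ʳ F ls c = ∼-trans (⊗-comm _ _) (∼-trans (∼-sym (∑ₗ-⊗ˡ c F ls)) (∑ₗ-cong (All.tabulate (λ _ → ⊗-comm _ _))))

  ψ : ℕ → List R → Tm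
  ψ m       []       = [ 1ᴿ ]^[ m ]
  ψ zero    (x ∷ xs) = 𝟘
  ψ (suc m) (x ∷ xs) = [ x ]^[ 1 ] ⊗ ψ m xs

  ψ¹≈oneTimes : ∀ m υ → ψ m (υ ∷ []) ∼ oneTimes m υ
  ψ¹≈oneTimes zero    υ = ∼-refl
  ψ¹≈oneTimes (suc m) υ = ⊗-comm _ _

  ψ-cong-head : ∀ m {x y} xs → x ≈ᴿ y → ψ m (x ∷ xs) ∼ ψ m (y ∷ xs)
  ψ-cong-head zero    xs x≈y = ∼-refl
  ψ-cong-head (suc m) xs x≈y = ⊗-cong (gen-cong 1 x≈y) ∼-refl

  ψ-vanish : ∀ m xs → m ℕ.< length xs → ψ m xs ∼ 𝟘
  ψ-vanish zero    (x ∷ xs) _           = ∼-refl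
  ψ-vanish (suc m) (x ∷ xs) (s≤s m<∣xs∣) = ∼-trans (⊗-cong ∼-refl (ψ-vanish m xs m<∣xs∣)) (zeroʳ _)

  ψ-split : ∀ m xs → length xs ℕ.≤ m → ψ m xs ∼ prod¹ xs ⊗ [ 1ᴿ ]^[ m ∸ length xs ]
  ψ-split m       []       _          = ∼-sym (⊗-idˡ _)
  ψ-split (suc m) (x ∷ xs) (s≤s ∣xs∣≤m) = ∼-trans (⊗-cong ∼-refl (ψ-split m xs ∣xs∣≤m)) (∼-sym (⊗-assoc _ _ _))

  ψ-swap : ∀ m b x xs → [ b ]^[ 1 ] ⊗ ψ m (x ∷ xs) ∼ [ x ]^[ 1 ] ⊗ ψ m (b ∷ xs)
  ψ-swap zero    b x xs = ∼-trans (zeroʳ _) (∼-sym (zeroʳ _))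
  ψ-swap (suc m) b x xs = solve 3 (λ b x t → b :* (x :* t) := x :* (b :* t)) ∼-refl _ _ _

  ψ-∷-split : ∀ m b xs → length xs ℕ.≤ m → ψ m (b ∷ xs) ∼ prod¹ xs ⊗ ψ (m ∸ length xs) (b ∷ [])
  ψ-∷-split m       b []       _            = ∼-sym (⊗-idˡ _)
  ψ-∷-split (suc m) b (x ∷ xs) (s≤s ∣xs∣≤m) = begin
    [ b ]^[ 1 ] ⊗ ψ m (x ∷ xs)                                  ≈⟨ ψ-swap m b x xs ⟩
    [ x ]^[ 1 ] ⊗ ψ m (b ∷ xs)                                  ≈⟨ ⊗-cong ∼-refl (ψ-∷-split m b xs ∣xs∣≤m) ⟩
    [ x ]^[ 1 ] ⊗ (prod¹ xs ⊗ ψ (m ∸ length xs) (b ∷ []))      ≈⟨ ⊗-assoc _ _ _ ⟨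
    prod¹ (x ∷ xs) ⊗ ψ (m ∸ length xs) (b ∷ [])                 ∎

  ψ¹-+ : ∀ m x y → ψ m (x +ᴿ y ∷ []) ∼ ψ m (x ∷ []) ⊕ ψ m (y ∷ [])
  ψ¹-+ zero    x y = ∼-sym (⊕-idˡ 𝟘)
  ψ¹-+ (suc m) x y = ∼-trans (⊗-cong (dp¹-+ x y) ∼-refl) (solve 3 (λ a b c → (a :+ b) :* c := a :* c :+ b :* c) ∼-refl _ _ _)

  ψ¹-· : ∀ m α x → ψ m (α · x ∷ []) ∼ α ⊙ ψ m (x ∷ [])
  ψ¹-· zero    α x = ∼-sym (∼-trans (⊙≈scalar⊗ α 𝟘) (zeroʳ _))
  ψ¹-· (suc m) α x = ∼-trans (⊗-cong (dp¹-· α x) ∼-refl) (∼-sym (⊙-⊗ α _ _))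

  ψ¹-1 : ∀ m → ψ m (1ᴿ ∷ []) ∼ ⟪ m ⟫ ⊗ [ 1ᴿ ]^[ m ]
  ψ¹-1 zero    = ∼-sym (zeroˡ _)
  ψ¹-1 (suc m) = dp¹⊗dp 1ᴿ m

  δprod¹-ones : ∀ b p → δprod¹ b (replicate p 1ᴿ) ∼ ⟪ p ! ⟫ ⊗ ψ p (b ∷ [])
  δprod¹-ones b zero    = ∼-sym (zeroʳ _)
  δprod¹-ones b (suc q) = begin
    [ b *ᴿ 1ᴿ ]^[ 1 ] ⊗ prod¹ (replicate q 1ᴿ) ⊕ [ 1ᴿ ]^[ 1 ] ⊗ δprod¹ b (replicate q 1ᴿ)
      ≈⟨ ⊕-cong (⊗-cong (gen-cong 1 (A.*-identityʳ b)) (prod¹-replicate q 1ᴿ)) (⊗-cong ∼-refl (δprod¹-ones b q)) ⟩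
    B ⊗ (F ⊗ O) ⊕ [ 1ᴿ ]^[ 1 ] ⊗ (F ⊗ ψ q (b ∷ []))
      ≈⟨ ⊕-cong ∼-refl (solve 3 (λ o f t → o :* (f :* t) := f :* (o :* t)) ∼-refl _ _ _) ⟩
    B ⊗ (F ⊗ O) ⊕ F ⊗ ([ 1ᴿ ]^[ 1 ] ⊗ ψ q (b ∷ []))
      ≈⟨ ⊕-cong ∼-refl (⊗-cong ∼-refl (one⊗ψ¹ q)) ⟩
    B ⊗ (F ⊗ O) ⊕ F ⊗ (⟪ q ⟫ ⊗ (B ⊗ O))
      ≈⟨ solve 4 (λ b f o m → b :* (f :* o) :+ f :* (m :* (b :* o)) := ((con (+ 1) :+ m) :* f) :* (b :* o)) ∼-refl _ _ _ _ ⟩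
    ((𝟙 ⊕ ⟪ q ⟫) ⊗ F) ⊗ (B ⊗ O)
      ≈⟨ ⊗-cong (∼-trans (⊗-cong (∼-sym (⟪⟫-suc q)) ∼-refl) (∼-sym (⟪⟫-* (suc q) (q !)))) ∼-refl ⟩
    ⟪ suc q ! ⟫ ⊗ ψ (suc q) (b ∷ [])
      ∎
    where
    B = [ b ]^[ 1 ]
    F = ⟪ q ! ⟫
    O = [ 1ᴿ ]^[ q ]
    one⊗ψ¹ : ∀ q → [ 1ᴿ ]^[ 1 ] ⊗ ψ q (b ∷ []) ∼ ⟪ q ⟫ ⊗ ([ b ]^[ 1 ] ⊗ [ 1ᴿ ]^[ q ])
    one⊗ψ¹ zero    = ∼-trans (zeroʳ _) (∼-sym (zeroˡ _))
    one⊗ψ¹ (suc r) = begin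
      [ 1ᴿ ]^[ 1 ] ⊗ (B ⊗ [ 1ᴿ ]^[ r ])               ≈⟨ solve 3 (λ o b t → o :* (b :* t) := b :* (o :* t)) ∼-refl _ _ _ ⟩
      B ⊗ ([ 1ᴿ ]^[ 1 ] ⊗ [ 1ᴿ ]^[ r ])               ≈⟨ ⊗-cong ∼-refl (dp¹⊗dp 1ᴿ r) ⟩
      B ⊗ (⟪ suc r ⟫ ⊗ [ 1ᴿ ]^[ suc r ])             ≈⟨ solve 3 (λ b m t → b :* (m :* t) := m :* (b :* t)) ∼-refl _ _ _ ⟩
      ⟪ suc r ⟫ ⊗ (B ⊗ [ 1ᴿ ]^[ suc r ])             ∎

  δprod¹-++ : ∀ b xs ys → δprod¹ b (xs ++ ys) ∼ δprod¹ b xs ⊗ prod¹ ys ⊕ prod¹ xs ⊗ δprod¹ b ys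
  δprod¹-++ b []       ys = solve 2 (λ g h → h := con (+ 0) :* g :+ con (+ 1) :* h) ∼-refl _ _
  δprod¹-++ b (x ∷ xs) ys = begin
    [ b *ᴿ x ]^[ 1 ] ⊗ prod¹ (xs ++ ys) ⊕ [ x ]^[ 1 ] ⊗ δprod¹ b (xs ++ ys)
      ≈⟨ ⊕-cong (⊗-cong ∼-refl (prod¹-++ xs ys)) (⊗-cong ∼-refl (δprod¹-++ b xs ys)) ⟩
    [ b *ᴿ x ]^[ 1 ] ⊗ (prod¹ xs ⊗ prod¹ ys) ⊕ [ x ]^[ 1 ] ⊗ (δprod¹ b xs ⊗ prod¹ ys ⊕ prod¹ xs ⊗ δprod¹ b ys)
      ≈⟨ solve 6 (λ p q g g′ h h′ → p :* (g :* g′) :+ q :* (h :* g′ :+ g :* h′) := (p :* g :+ q :* h) :* g′ :+ (q :* g) :* h′)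
           ∼-refl _ _ _ _ _ _ ⟩
    δprod¹ b (x ∷ xs) ⊗ prod¹ ys ⊕ prod¹ (x ∷ xs) ⊗ δprod¹ b ys
      ∎

  δprod¹≈∑ₗ : ∀ b xs → δprod¹ b xs ∼ ∑ₗ prod¹ (replaceEach (b *ᴿ_) xs)
  δprod¹≈∑ₗ b []       = ∼-refl
  δprod¹≈∑ₗ b (x ∷ xs) = ⊕-cong ∼-refl (begin
    [ x ]^[ 1 ] ⊗ δprod¹ b xs                                ≈⟨ ⊗-cong ∼-refl (δprod¹≈∑ₗ b xs) ⟩
    [ x ]^[ 1 ] ⊗ ∑ₗ prod¹ L                                 ≈⟨ ∑ₗ-⊗ˡ _ prod¹ L ⟨
    ∑ₗ (λ l → prod¹ (x ∷ l)) L                               ≡⟨ ∑ₗ-map prod¹ (x ∷_) L ⟨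
    ∑ₗ prod¹ (map (x ∷_) L)                                  ∎)
    where L = replaceEach (b *ᴿ_) xs

  ∑ψ-split : ∀ m b xs → length xs ℕ.≤ m →
             ∑ₗ (ψ m) (replaceEach (b *ᴿ_) xs) ∼ δprod¹ b xs ⊗ [ 1ᴿ ]^[ m ∸ length xs ]
  ∑ψ-split m b xs ∣xs∣≤m = begin
    ∑ₗ (ψ m) L                                                  ≈⟨ ∑ₗ-cong (All.map split (length-∈replaceEach (b *ᴿ_) xs)) ⟩
    ∑ₗ (λ zs → prod¹ zs ⊗ [ 1ᴿ ]^[ m ∸ length xs ]) L           ≈⟨ ∑ₗ-⊗ʳ prod¹ L _ ⟨
    ∑ₗ prod¹ L ⊗ [ 1ᴿ ]^[ m ∸ length xs ]                       ≈⟨ ⊗-cong (δprod¹≈∑ₗ b xs) ∼-refl ⟨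
    δprod¹ b xs ⊗ [ 1ᴿ ]^[ m ∸ length xs ]                      ∎
    where
    L = replaceEach (b *ᴿ_) xs
    split : ∀ {zs} → length zs ≡ length xs → ψ m zs ∼ prod¹ zs ⊗ [ 1ᴿ ]^[ m ∸ length xs ]
    split {zs} eq = ≡.subst (λ k → ψ m zs ∼ prod¹ zs ⊗ [ 1ᴿ ]^[ m ∸ k ]) eq (ψ-split m zs (≡.subst (ℕ._≤ m) (≡.sym eq) ∣xs∣≤m))

  -- The product formula for ψ n [ b ] ⋆ ψ n xs

  InΓ-⊖ : ∀ {m x} → InΓ m x → InΓ m (⊖ x)
  InΓ-⊖ x∈Γ = span-∼ (-1⊙ _) (span-⊙ _ x∈Γ)

  InΓ-⟪⟫ : ∀ {m x} N → InΓ m x → InΓ m (⟪ N ⟫ ⊗ x)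
  InΓ-⟪⟫ N x∈Γ = span-∼ (fromℕ⊙ N _) (span-⊙ _ x∈Γ)

  InΓ-⊗ : ∀ {d m x y} → Monomial d x → InΓ m y → InΓ (d ℕ.+ m) (x ⊗ y)
  InΓ-⊗ x∈M (span-mono y∈M)  = span-mono (mono-⊗ x∈M y∈M)
  InΓ-⊗ x∈M span-𝟘           = span-∼ (∼-sym (zeroʳ _)) span-𝟘
  InΓ-⊗ x∈M (span-⊕ y∈Γ y′∈Γ) = span-∼ (∼-sym (⊗-distribˡ _ _ _)) (span-⊕ (InΓ-⊗ x∈M y∈Γ) (InΓ-⊗ x∈M y′∈Γ))
  InΓ-⊗ x∈M (span-⊙ α y∈Γ)   = span-∼ (∼-sym (⊗-⊙ʳ α _ _)) (span-⊙ α (InΓ-⊗ x∈M y∈Γ))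
  InΓ-⊗ x∈M (span-∼ eq y∈Γ)  = span-∼ (⊗-cong ∼-refl eq) (InΓ-⊗ x∈M y∈Γ)

  prod¹-Monomial : ∀ xs → Monomial (length xs) (prod¹ xs)
  prod¹-Monomial []       = mono-𝟙
  prod¹-Monomial (x ∷ xs) = mono-⊗ (mono-gen x 1) (prod¹-Monomial xs)

  prod¹-InΓ : ∀ {m} xs → length xs ≡ m → InΓ m (prod¹ xs)
  prod¹-InΓ xs ≡.refl = span-mono (prod¹-Monomial xs)

  Δ-InΓ : ∀ {m f} xs → (∀ z → InΓ m (f z)) → ∀ z → InΓ m (Δ xs f z)
  Δ-InΓ []       f∈Γ z = f∈Γ z
  Δ-InΓ (x ∷ xs) f∈Γ z = span-⊕ (Δ-InΓ xs f∈Γ (z +ᴿ x)) (InΓ-⊖ (Δ-InΓ xs f∈Γ z))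

  dp-InΓ : ∀ m z → InΓ m [ z ]^[ m ]
  dp-InΓ m z = span-mono (mono-gen z m)

  ψ-InΓ : ∀ m xs → InΓ m (ψ m xs)
  ψ-InΓ m       []       = dp-InΓ m 1ᴿ
  ψ-InΓ zero    (x ∷ xs) = span-𝟘
  ψ-InΓ (suc m) (x ∷ xs) = InΓ-⊗ (mono-gen x 1) (ψ-InΓ m xs)

  module ⋆-Properties {n} (μ : GammaMult n) where
    open GammaMult μ

    ⋆-⊖ˡ : ∀ {x y} → InΓ n x → InΓ n y → (⊖ x) ⋆ y ∼ ⊖ (x ⋆ y)
    ⋆-⊖ˡ x∈Γ y∈Γ = ∼-trans (⋆-cong (InΓ-⊖ x∈Γ) (span-⊙ _ x∈Γ) y∈Γ y∈Γ (∼-sym (-1⊙ _)) ∼-refl)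
                            (∼-trans (⋆-⊙ˡ _ x∈Γ y∈Γ) (-1⊙ _))

    ⋆-⊖ʳ : ∀ {x y} → InΓ n x → InΓ n y → x ⋆ (⊖ y) ∼ ⊖ (x ⋆ y)
    ⋆-⊖ʳ x∈Γ y∈Γ = ∼-trans (⋆-cong x∈Γ x∈Γ (InΓ-⊖ y∈Γ) (span-⊙ _ y∈Γ) ∼-refl (∼-sym (-1⊙ _)))
                            (∼-trans (⋆-⊙ʳ _ x∈Γ y∈Γ) (-1⊙ _))

    ⋆-⟪⟫ˡ : ∀ N {x y} → InΓ n x → InΓ n y → (⟪ N ⟫ ⊗ x) ⋆ y ∼ ⟪ N ⟫ ⊗ (x ⋆ y)
    ⋆-⟪⟫ˡ N x∈Γ y∈Γ = ∼-trans (⋆-cong (InΓ-⟪⟫ N x∈Γ) (span-⊙ _ x∈Γ) y∈Γ y∈Γ (∼-sym (fromℕ⊙ N _)) ∼-refl)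
                               (∼-trans (⋆-⊙ˡ _ x∈Γ y∈Γ) (fromℕ⊙ N _))

    ⋆-⟪⟫ʳ : ∀ N {x y} → InΓ n x → InΓ n y → x ⋆ (⟪ N ⟫ ⊗ y) ∼ ⟪ N ⟫ ⊗ (x ⋆ y)
    ⋆-⟪⟫ʳ N x∈Γ y∈Γ = ∼-trans (⋆-cong x∈Γ x∈Γ (InΓ-⟪⟫ N y∈Γ) (span-⊙ _ y∈Γ) ∼-refl (∼-sym (fromℕ⊙ N _)))
                               (∼-trans (⋆-⊙ʳ _ x∈Γ y∈Γ) (fromℕ⊙ N _))

    𝟘⋆ : ∀ {y} → InΓ n y → 𝟘 ⋆ y ∼ 𝟘
    𝟘⋆ y∈Γ = ∼-trans (⋆-cong span-𝟘 (span-⊙ K.0# span-𝟘) y∈Γ y∈Γ (∼-sym (0⊙ 𝟘)) ∼-refl)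
                     (∼-trans (⋆-⊙ˡ K.0# span-𝟘 y∈Γ) (0⊙ _))

    Δ-⋆ˡ : ∀ xs {f y} → (∀ z → InΓ n (f z)) → InΓ n y → ∀ z → Δ xs f z ⋆ y ∼ Δ xs (λ z → f z ⋆ y) z
    Δ-⋆ˡ []       f∈Γ y∈Γ z = ∼-refl
    Δ-⋆ˡ (x ∷ xs) f∈Γ y∈Γ z = ∼-trans (⋆-distribʳ (Δ-InΓ xs f∈Γ _) (InΓ-⊖ (Δ-InΓ xs f∈Γ z)) y∈Γ)
      (⊕-cong (Δ-⋆ˡ xs f∈Γ y∈Γ (z +ᴿ x)) (∼-trans (⋆-⊖ˡ (Δ-InΓ xs f∈Γ z) y∈Γ) (⊖-cong (Δ-⋆ˡ xs f∈Γ y∈Γ z))))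

    Δ-⋆ʳ : ∀ xs {f y} → InΓ n y → (∀ z → InΓ n (f z)) → ∀ z → y ⋆ Δ xs f z ∼ Δ xs (λ z → y ⋆ f z) z
    Δ-⋆ʳ []       y∈Γ f∈Γ z = ∼-refl
    Δ-⋆ʳ (x ∷ xs) y∈Γ f∈Γ z = ∼-trans (⋆-distribˡ y∈Γ (Δ-InΓ xs f∈Γ _) (InΓ-⊖ (Δ-InΓ xs f∈Γ z)))
      (⊕-cong (Δ-⋆ʳ xs y∈Γ f∈Γ (z +ᴿ x)) (∼-trans (⋆-⊖ʳ y∈Γ (Δ-InΓ xs f∈Γ z)) (⊖-cong (Δ-⋆ʳ xs y∈Γ f∈Γ z))))

  module ProductFormula (k : ℕ) (μ : GammaMult (suc k)) (n!⁻¹ : FactorialInvertible K (suc k)) where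
    open GammaMult μ
    open ⋆-Properties μ

    private
      n : ℕ
      n = suc k

      ψ¹-InΓ : ∀ b → InΓ n (ψ n (b ∷ []))
      ψ¹-InΓ b = ψ-InΓ n (b ∷ [])

    ψ¹-polarisation : ∀ b → ⟪ k ! ⟫ ⊗ ψ n (b ∷ []) ∼ Δ (b ∷ replicate k 1ᴿ) [_]^[ n ] 0ᴿ
    ψ¹-polarisation b = begin
      ⟪ k ! ⟫ ⊗ ([ b ]^[ 1 ] ⊗ [ 1ᴿ ]^[ k ])     ≈⟨ solve 3 (λ f p o → f :* (p :* o) := p :* (f :* o)) ∼-refl _ _ _ ⟩
      [ b ]^[ 1 ] ⊗ (⟪ k ! ⟫ ⊗ [ 1ᴿ ]^[ k ])     ≈⟨ ⊗-cong ∼-refl (prod¹-replicate k 1ᴿ) ⟨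
      prod¹ (b ∷ replicate k 1ᴿ)                 ≈⟨ Δ-dp-top (b ∷ replicate k 1ᴿ) 0ᴿ (≡.cong suc (List.length-replicate k)) ⟨
      Δ (b ∷ replicate k 1ᴿ) [_]^[ n ] 0ᴿ        ∎

    ψ¹⋆dp : ∀ b s → ψ n (b ∷ []) ⋆ [ s ]^[ n ] ∼ δdp b k s
    ψ¹⋆dp b s = !-cancel n!⁻¹ (ℕ.n≤1+n k) (begin
      ⟪ k ! ⟫ ⊗ (ψ n (b ∷ []) ⋆ [ s ]^[ n ])        ≈⟨ ⋆-⟪⟫ˡ (k !) (ψ¹-InΓ b) s∈Γ ⟨
      (⟪ k ! ⟫ ⊗ ψ n (b ∷ [])) ⋆ [ s ]^[ n ]        ≈⟨ ⋆-cong (InΓ-⟪⟫ (k !) (ψ¹-InΓ b)) (Δ-InΓ ys (dp-InΓ n) 0ᴿ) s∈Γ s∈Γ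
                                                               (ψ¹-polarisation b) ∼-refl ⟩
      Δ ys [_]^[ n ] 0ᴿ ⋆ [ s ]^[ n ]               ≈⟨ Δ-⋆ˡ ys (dp-InΓ n) s∈Γ 0ᴿ ⟩
      Δ ys (λ z → [ z ]^[ n ] ⋆ [ s ]^[ n ]) 0ᴿ      ≈⟨ Δ-cong ys (λ z → ⋆-dp z s) 0ᴿ ⟩
      Δ ys (λ z → [ z *ᴿ s ]^[ n ]) 0ᴿ               ≈⟨ Δ-scale ys (gen-cong n) s 0ᴿ ⟩
      Δ (map (_*ᴿ s) ys) [_]^[ n ] (0ᴿ *ᴿ s)         ≈⟨ Δ-dp-top (map (_*ᴿ s) ys) _ (≡.trans (List.length-map (_*ᴿ s) ys)
                                                                                    (≡.cong suc (List.length-replicate k))) ⟩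
      [ b *ᴿ s ]^[ 1 ] ⊗ prod¹ (map (_*ᴿ s) (replicate k 1ᴿ))
                                                    ≡⟨ ≡.cong (λ xs → [ b *ᴿ s ]^[ 1 ] ⊗ prod¹ xs) (List.map-replicate (_*ᴿ s) k 1ᴿ) ⟩
      [ b *ᴿ s ]^[ 1 ] ⊗ prod¹ (replicate k (1ᴿ *ᴿ s)) ≈⟨ ⊗-cong ∼-refl (prod¹-replicate k _) ⟩
      [ b *ᴿ s ]^[ 1 ] ⊗ (⟪ k ! ⟫ ⊗ [ 1ᴿ *ᴿ s ]^[ k ]) ≈⟨ ⊗-cong ∼-refl (⊗-cong ∼-refl (gen-cong k (A.*-identityˡ s))) ⟩
      [ b *ᴿ s ]^[ 1 ] ⊗ (⟪ k ! ⟫ ⊗ [ s ]^[ k ])      ≈⟨ solve 3 (λ p f o → p :* (f :* o) := f :* (p :* o)) ∼-refl _ _ _ ⟩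
      ⟪ k ! ⟫ ⊗ δdp b k s                            ∎)
      where
      ys = b ∷ replicate k 1ᴿ
      s∈Γ = dp-InΓ n s

    ψ¹⋆prod¹ : ∀ b zs → length zs ≡ n → ψ n (b ∷ []) ⋆ prod¹ zs ∼ δprod¹ b zs
    ψ¹⋆prod¹ b zs ∣zs∣≡n = begin
      ψ n (b ∷ []) ⋆ prod¹ zs                            ≈⟨ ⋆-cong (ψ¹-InΓ b) (ψ¹-InΓ b) (prod¹-InΓ zs ∣zs∣≡n) (Δ-InΓ zs (dp-InΓ n) 0ᴿ)
                                                                   ∼-refl (∼-sym (Δ-dp-top zs 0ᴿ ∣zs∣≡n)) ⟩
      ψ n (b ∷ []) ⋆ Δ zs [_]^[ n ] 0ᴿ                   ≈⟨ Δ-⋆ʳ zs (ψ¹-InΓ b) (dp-InΓ n) 0ᴿ ⟩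
      Δ zs (λ z → ψ n (b ∷ []) ⋆ [ z ]^[ n ]) 0ᴿ         ≈⟨ Δ-cong zs (ψ¹⋆dp b) 0ᴿ ⟩
      Δ zs (δdp b k) 0ᴿ                                  ≈⟨ Δ-δdp-top b zs 0ᴿ ∣zs∣≡n ⟩
      δprod¹ b zs                                        ∎

    ψ¹⋆ψ : ∀ b xs → length xs ℕ.≤ n →
           ψ n (b ∷ []) ⋆ ψ n xs ∼ ψ n (b ∷ xs) ⊕ ∑ₗ (ψ n) (replaceEach (b *ᴿ_) xs)
    ψ¹⋆ψ b xs ∣xs∣≤n = !-cancel n!⁻¹ (ℕ.m∸n≤m n (length xs)) (begin
      P ⊗ (ψ n (b ∷ []) ⋆ ψ n xs)                     ≈⟨ ⋆-⟪⟫ʳ (p !) (ψ¹-InΓ b) (ψ-InΓ n xs) ⟨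
      ψ n (b ∷ []) ⋆ (P ⊗ ψ n xs)                     ≈⟨ ⋆-cong (ψ¹-InΓ b) (ψ¹-InΓ b) (InΓ-⟪⟫ (p !) (ψ-InΓ n xs))
                                                                 (prod¹-InΓ (xs ++ ones) ∣xs++ones∣≡n) ∼-refl padding ⟩
      ψ n (b ∷ []) ⋆ prod¹ (xs ++ ones)               ≈⟨ ψ¹⋆prod¹ b (xs ++ ones) ∣xs++ones∣≡n ⟩
      δprod¹ b (xs ++ ones)                           ≈⟨ δprod¹-++ b xs ones ⟩
      δprod¹ b xs ⊗ prod¹ ones ⊕ prod¹ xs ⊗ δprod¹ b ones
                                                      ≈⟨ ⊕-cong (⊗-cong ∼-refl (prod¹-replicate p 1ᴿ)) (⊗-cong ∼-refl (δprod¹-ones b p)) ⟩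
      δprod¹ b xs ⊗ (P ⊗ O) ⊕ prod¹ xs ⊗ (P ⊗ ψ p (b ∷ []))
                                                      ≈⟨ solve 5 (λ d f o g t → d :* (f :* o) :+ g :* (f :* t) := f :* (d :* o) :+ f :* (g :* t))
                                                           ∼-refl _ _ _ _ _ ⟩
      P ⊗ (δprod¹ b xs ⊗ O) ⊕ P ⊗ (prod¹ xs ⊗ ψ p (b ∷ []))
                                                      ≈⟨ ⊕-cong (⊗-cong ∼-refl (∑ψ-split n b xs ∣xs∣≤n)) (⊗-cong ∼-refl (ψ-∷-split n b xs ∣xs∣≤n)) ⟨
      P ⊗ ∑ₗ (ψ n) (replaceEach (b *ᴿ_) xs) ⊕ P ⊗ ψ n (b ∷ xs)
                                                      ≈⟨ solve 3 (λ f s t → f :* s :+ f :* t := f :* (t :+ s)) ∼-refl _ _ _ ⟩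
      P ⊗ (ψ n (b ∷ xs) ⊕ ∑ₗ (ψ n) (replaceEach (b *ᴿ_) xs)) ∎)
      where
      p = n ∸ length xs
      P = ⟪ p ! ⟫
      O = [ 1ᴿ ]^[ p ]
      ones = replicate p 1ᴿ
      ∣xs++ones∣≡n : length (xs ++ ones) ≡ n
      ∣xs++ones∣≡n = ≡.trans (List.length-++ xs) (≡.trans (≡.cong (length xs ℕ.+_) (List.length-replicate p)) (ℕ.m+[n∸m]≡n ∣xs∣≤n))
      padding : P ⊗ ψ n xs ∼ prod¹ (xs ++ ones)
      padding = begin
        P ⊗ ψ n xs                        ≈⟨ ⊗-cong ∼-refl (ψ-split n xs ∣xs∣≤n) ⟩
        P ⊗ (prod¹ xs ⊗ O)                ≈⟨ solve 3 (λ f g o → f :* (g :* o) := g :* (f :* o)) ∼-refl _ _ _ ⟩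
        prod¹ xs ⊗ (P ⊗ O)                ≈⟨ ⊗-cong ∼-refl (prod¹-replicate p 1ᴿ) ⟨
        prod¹ xs ⊗ prod¹ ones             ≈⟨ prod¹-++ xs ones ⟨
        prod¹ (xs ++ ones)                ∎

  ψ¹⋆ψ : ∀ n (μ : GammaMult n) → FactorialInvertible K n → ∀ b xs → length xs ℕ.≤ n →
           GammaMult._⋆_ μ (ψ n (b ∷ [])) (ψ n xs) ∼ ψ n (b ∷ xs) ⊕ ∑ₗ (ψ n) (replaceEach (b *ᴿ_) xs)
  ψ¹⋆ψ zero    μ _     b [] z≤n = ∼-trans (⋆-Properties.𝟘⋆ μ (dp-InΓ 0 1ᴿ)) (∼-sym (⊕-idˡ 𝟘))
  ψ¹⋆ψ (suc k) μ n!⁻¹         = ProductFormula.ψ¹⋆ψ k μ n!⁻¹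

  -- Spanning sets of Γ^n and of R

  data Prod¹Span (d : ℕ) : Tm → Set (c ⊔ ℓ ⊔ a ⊔ ℓa) where
    prod¹-span : ∀ xs → length xs ≡ d → Prod¹Span d (prod¹ xs)
    𝟘-span     : Prod¹Span d 𝟘
    ⊕-span     : ∀ {x y} → Prod¹Span d x → Prod¹Span d y → Prod¹Span d (x ⊕ y)
    ⊙-span     : ∀ α {x} → Prod¹Span d x → Prod¹Span d (α ⊙ x)
    ∼-span     : ∀ {x y} → x ∼ y → Prod¹Span d x → Prod¹Span d y

  Prod¹Span-prod¹⊗ : ∀ {d e y} xs → length xs ≡ d → Prod¹Span e y → Prod¹Span (d ℕ.+ e) (prod¹ xs ⊗ y)
  Prod¹Span-prod¹⊗ xs ∣xs∣≡d (prod¹-span ys ∣ys∣≡e) = ∼-span (prod¹-++ xs ys)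
    (prod¹-span (xs ++ ys) (≡.trans (List.length-++ xs) (≡.cong₂ ℕ._+_ ∣xs∣≡d ∣ys∣≡e)))
  Prod¹Span-prod¹⊗ xs ∣xs∣≡d 𝟘-span             = ∼-span (∼-sym (zeroʳ _)) 𝟘-span
  Prod¹Span-prod¹⊗ xs ∣xs∣≡d (⊕-span y∈ y′∈)     = ∼-span (∼-sym (⊗-distribˡ _ _ _))
    (⊕-span (Prod¹Span-prod¹⊗ xs ∣xs∣≡d y∈) (Prod¹Span-prod¹⊗ xs ∣xs∣≡d y′∈))
  Prod¹Span-prod¹⊗ xs ∣xs∣≡d (⊙-span α y∈)       = ∼-span (∼-sym (⊗-⊙ʳ α _ _)) (⊙-span α (Prod¹Span-prod¹⊗ xs ∣xs∣≡d y∈))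
  Prod¹Span-prod¹⊗ xs ∣xs∣≡d (∼-span eq y∈)      = ∼-span (⊗-cong ∼-refl eq) (Prod¹Span-prod¹⊗ xs ∣xs∣≡d y∈)

  Prod¹Span-⊗ : ∀ {d e x y} → Prod¹Span d x → Prod¹Span e y → Prod¹Span (d ℕ.+ e) (x ⊗ y)
  Prod¹Span-⊗ (prod¹-span xs ∣xs∣≡d) y∈ = Prod¹Span-prod¹⊗ xs ∣xs∣≡d y∈
  Prod¹Span-⊗ 𝟘-span             y∈ = ∼-span (∼-sym (∼-trans (⊗-comm _ _) (zeroʳ _))) 𝟘-span
  Prod¹Span-⊗ (⊕-span x∈ x′∈)    y∈ = ∼-span (∼-sym (solve 3 (λ a b c → (a :+ b) :* c := a :* c :+ b :* c) ∼-refl _ _ _))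
    (⊕-span (Prod¹Span-⊗ x∈ y∈) (Prod¹Span-⊗ x′∈ y∈))
  Prod¹Span-⊗ (⊙-span α x∈)      y∈ = ∼-span (⊙-⊗ α _ _) (⊙-span α (Prod¹Span-⊗ x∈ y∈))
  Prod¹Span-⊗ (∼-span eq x∈)     y∈ = ∼-span (⊗-cong eq ∼-refl) (Prod¹Span-⊗ x∈ y∈)

  Monomial⇒Prod¹Span : ∀ {d y} → Monomial d y → Prod¹Span d (⟪ d ! ⟫ ⊗ y)
  Monomial⇒Prod¹Span mono-𝟙 = ∼-span (∼-sym (⊗-idˡ 𝟙)) (prod¹-span [] ≡.refl)
  Monomial⇒Prod¹Span (mono-gen m i) = ∼-span (prod¹-replicate i m) (prod¹-span (replicate i m) (List.length-replicate i))
  Monomial⇒Prod¹Span (mono-⊗ {d} {e} {x} {y} x∈ y∈) with k![n∸k]!∣n! (ℕ.m≤m+n d e)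
  ... | divides q [d+e]!≡q*d!e! = ∼-span binomial
          (∼-span (fromℕ⊙ q _) (⊙-span _ (Prod¹Span-⊗ (Monomial⇒Prod¹Span x∈) (Monomial⇒Prod¹Span y∈))))
    where
    binomial : ⟪ q ⟫ ⊗ ((⟪ d ! ⟫ ⊗ x) ⊗ (⟪ e ! ⟫ ⊗ y)) ∼ ⟪ (d ℕ.+ e) ! ⟫ ⊗ (x ⊗ y)
    binomial = begin
      ⟪ q ⟫ ⊗ ((⟪ d ! ⟫ ⊗ x) ⊗ (⟪ e ! ⟫ ⊗ y))
        ≈⟨ solve 5 (λ a b c u v → a :* ((b :* u) :* (c :* v)) := (a :* (b :* c)) :* (u :* v)) ∼-refl _ _ _ _ _ ⟩
      (⟪ q ⟫ ⊗ (⟪ d ! ⟫ ⊗ ⟪ e ! ⟫)) ⊗ (x ⊗ y)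
        ≈⟨ ⊗-cong (∼-trans (⟪⟫-* q _) (⊗-cong ∼-refl (⟪⟫-* (d !) (e !)))) ∼-refl ⟨
      ⟪ q ℕ.* (d ! ℕ.* e !) ⟫ ⊗ (x ⊗ y)
        ≡⟨ ≡.cong (λ t → ⟪ t ⟫ ⊗ (x ⊗ y)) (≡.subst (λ t → (d ℕ.+ e) ! ≡ q ℕ.* (d ! ℕ.* t !)) (ℕ.m+n∸m≡n d e) [d+e]!≡q*d!e!) ⟨
      ⟪ (d ℕ.+ e) ! ⟫ ⊗ (x ⊗ y)
        ∎

  module _ {ι} {I : Set ι} (r : I → R) where

    evalWord-++ : ∀ i is j js → evalWord A r i (is ++ j ∷ js) ≈ᴿ evalWord A r i is *ᴿ evalWord A r j js
    evalWord-++ i []        j js = A.refl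
    evalWord-++ i (i′ ∷ is) j js = A.trans (A.*-cong A.refl (evalWord-++ i′ is j js)) (A.sym (A.*-assoc _ _ _))

    monomial-⁺++⁺ : ∀ v w → monomial A r (v ⁺++⁺ w) ≈ᴿ monomial A r v *ᴿ monomial A r w
    monomial-⁺++⁺ (i ∷ is) (j ∷ js) = evalWord-++ i is j js

    data MonomialSpan : R → Set (c ⊔ a ⊔ ℓa ⊔ ι) where
      monomial-span : ∀ w → MonomialSpan (monomial A r w)
      1-span        : MonomialSpan 1ᴿ
      +-span        : ∀ {x y} → MonomialSpan x → MonomialSpan y → MonomialSpan (x +ᴿ y)
      ·-span        : ∀ α {x} → MonomialSpan x → MonomialSpan (α · x)
      ≈-span        : ∀ {x y} → x ≈ᴿ y → MonomialSpan x → MonomialSpan y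

    MonomialSpan-monomial* : ∀ w {y} → MonomialSpan y → MonomialSpan (monomial A r w *ᴿ y)
    MonomialSpan-monomial* w (monomial-span v) = ≈-span (monomial-⁺++⁺ w v) (monomial-span (w ⁺++⁺ v))
    MonomialSpan-monomial* w 1-span            = ≈-span (A.sym (A.*-identityʳ _)) (monomial-span w)
    MonomialSpan-monomial* w (+-span y∈ y′∈)   = ≈-span (A.sym (A.distribˡ _ _ _))
      (+-span (MonomialSpan-monomial* w y∈) (MonomialSpan-monomial* w y′∈))
    MonomialSpan-monomial* w (·-span α y∈)     = ≈-span (A.·-*ʳ α _ _) (·-span α (MonomialSpan-monomial* w y∈))
    MonomialSpan-monomial* w (≈-span eq y∈)    = ≈-span (A.*-cong A.refl eq) (MonomialSpan-monomial* w y∈)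

    MonomialSpan-* : ∀ {x y} → MonomialSpan x → MonomialSpan y → MonomialSpan (x *ᴿ y)
    MonomialSpan-* (monomial-span w) y∈ = MonomialSpan-monomial* w y∈
    MonomialSpan-* 1-span            y∈ = ≈-span (A.sym (A.*-identityˡ _)) y∈
    MonomialSpan-* (+-span x∈ x′∈)   y∈ = ≈-span (A.sym (A.distribʳ _ _ _)) (+-span (MonomialSpan-* x∈ y∈) (MonomialSpan-* x′∈ y∈))
    MonomialSpan-* (·-span α x∈)     y∈ = ≈-span (A.·-*ˡ α _ _) (·-span α (MonomialSpan-* x∈ y∈))
    MonomialSpan-* (≈-span eq x∈)    y∈ = ≈-span (A.*-cong eq A.refl) (MonomialSpan-* x∈ y∈)

    GeneratedR⇒MonomialSpan : ∀ {x} → GeneratedR A r x → MonomialSpan x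
    GeneratedR⇒MonomialSpan (gr-gen i)    = monomial-span (i ∷ [])
    GeneratedR⇒MonomialSpan gr-1          = 1-span
    GeneratedR⇒MonomialSpan (gr-+ x∈ y∈)  = +-span (GeneratedR⇒MonomialSpan x∈) (GeneratedR⇒MonomialSpan y∈)
    GeneratedR⇒MonomialSpan (gr-· α x∈)   = ·-span α (GeneratedR⇒MonomialSpan x∈)
    GeneratedR⇒MonomialSpan (gr-* x∈ y∈)  = MonomialSpan-* (GeneratedR⇒MonomialSpan x∈) (GeneratedR⇒MonomialSpan y∈)
    GeneratedR⇒MonomialSpan (gr-≈ eq x∈)  = ≈-span eq (GeneratedR⇒MonomialSpan x∈)

  -- The generated subalgebra

  module Generation (n : ℕ) (μ : GammaMult n) (n!⁻¹ : FactorialInvertible K n) {s} (S : Tm → Set s) where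
    open GammaMult μ using (_⋆_)

    G : Tm → Set (c ⊔ ℓ ⊔ a ⊔ ℓa ⊔ s)
    G = Generated μ S

    G-𝟘 : G 𝟘
    G-𝟘 = g-∼ (0⊙ _) (g-⊙ K.0# g-unit)

    G-⊖ : ∀ {x} → G x → G (⊖ x)
    G-⊖ x∈G = g-∼ (-1⊙ _) (g-⊙ _ x∈G)

    G-⊖⁻¹ : ∀ {x} → G (⊖ x) → G x
    G-⊖⁻¹ ⊖x∈G = g-∼ (-‿involutive _) (G-⊖ ⊖x∈G)

    G-⟪⟫ : ∀ N {x} → G x → G (⟪ N ⟫ ⊗ x)
    G-⟪⟫ N x∈G = g-∼ (fromℕ⊙ N _) (g-⊙ _ x∈G)

    G-!⁻¹ : ∀ {j x} → j ℕ.≤ n → G (⟪ j ! ⟫ ⊗ x) → G x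
    G-!⁻¹ j≤n j!x∈G with !-inverse n!⁻¹ j≤n
    ... | β , inverse = g-∼ (inverse _) (g-⊙ β j!x∈G)

    G-∑ₗ : ∀ {b} {B : Set b} {F : B → Tm} {ls} → All (λ l → G (F l)) ls → G (∑ₗ F ls)
    G-∑ₗ []             = G-𝟘
    G-∑ₗ (Fl∈G ∷ Fls∈G) = g-⊕ Fl∈G (G-∑ₗ Fls∈G)

    G-difference : ∀ {p x t} → p ∼ x ⊕ t → G p → G t → G x
    G-difference {p} {x} {t} p∼x+t p∈G t∈G = g-∼ x∼p-t (g-⊕ p∈G (G-⊖ t∈G))
      where
      x∼p-t : p ⊕ ⊖ t ∼ x
      x∼p-t = ∼-trans (⊕-cong p∼x+t ∼-refl) (solve 2 (λ x t → (x :+ t) :- t := x) ∼-refl x t)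

    module Factors {t} {B : Set t} (⟦_⟧ : B → R) (_∙_ : B → B → B) (⟦⟧-∙ : ∀ v w → ⟦ v ∙ w ⟧ ≈ᴿ ⟦ v ⟧ *ᴿ ⟦ w ⟧)
                  (deg : B → ℕ) (deg-∙ : ∀ v w → deg (v ∙ w) ≡ deg v ℕ.+ deg w) where

      ⟦_⟧* : List B → List R
      ⟦ ws ⟧* = map ⟦_⟧ ws

      totalDeg : List B → ℕ
      totalDeg = fold ℕ.+-0-commutativeMonoid deg

      ∑ψ-⟦⟧ : ∀ m w ws → ∑ₗ (ψ m ∘ ⟦_⟧*) (replaceEach (w ∙_) ws) ∼ ∑ₗ (ψ m) (replaceEach (⟦ w ⟧ *ᴿ_) ⟦ ws ⟧*)
      ∑ψ-⟦⟧ m w []       = ∼-refl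
      ∑ψ-⟦⟧ m w (v ∷ vs) = ⊕-cong (ψ-cong-head m _ (⟦⟧-∙ w v)) (tail m)
        where
        L  = replaceEach (w ∙_) vs
        L′ = replaceEach (⟦ w ⟧ *ᴿ_) ⟦ vs ⟧*
        tail : ∀ m → ∑ₗ (ψ m ∘ ⟦_⟧*) (map (v ∷_) L) ∼ ∑ₗ (ψ m) (map (⟦ v ⟧ ∷_) L′)
        tail zero = begin
          ∑ₗ (ψ 0 ∘ ⟦_⟧*) (map (v ∷_) L)      ≡⟨ ∑ₗ-map (ψ 0 ∘ ⟦_⟧*) (v ∷_) L ⟩
          ∑ₗ (λ _ → 𝟘) L                      ≈⟨ ∑ₗ-𝟘 L (λ _ → ∼-refl) ⟩
          𝟘                                   ≈⟨ ∑ₗ-𝟘 L′ (λ _ → ∼-refl) ⟨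
          ∑ₗ (λ _ → 𝟘) L′                     ≡⟨ ∑ₗ-map (ψ 0) (⟦ v ⟧ ∷_) L′ ⟨
          ∑ₗ (ψ 0) (map (⟦ v ⟧ ∷_) L′)        ∎
        tail (suc m) = begin
          ∑ₗ (ψ (suc m) ∘ ⟦_⟧*) (map (v ∷_) L)          ≡⟨ ∑ₗ-map (ψ (suc m) ∘ ⟦_⟧*) (v ∷_) L ⟩
          ∑ₗ (λ l → [ ⟦ v ⟧ ]^[ 1 ] ⊗ ψ m ⟦ l ⟧*) L      ≈⟨ ∑ₗ-⊗ˡ _ (ψ m ∘ ⟦_⟧*) L ⟩
          [ ⟦ v ⟧ ]^[ 1 ] ⊗ ∑ₗ (ψ m ∘ ⟦_⟧*) L            ≈⟨ ⊗-cong ∼-refl (∑ψ-⟦⟧ m w vs) ⟩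
          [ ⟦ v ⟧ ]^[ 1 ] ⊗ ∑ₗ (ψ m) L′                  ≈⟨ ∑ₗ-⊗ˡ _ (ψ m) L′ ⟨
          ∑ₗ (λ l → [ ⟦ v ⟧ ]^[ 1 ] ⊗ ψ m l) L′          ≡⟨ ∑ₗ-map (ψ (suc m)) (⟦ v ⟧ ∷_) L′ ⟨
          ∑ₗ (ψ (suc m)) (map (⟦ v ⟧ ∷_) L′)            ∎

      ψ¹⋆ψ-⟦⟧ : ∀ w ws → length ws ℕ.≤ n →
                  ψ n (⟦ w ⟧ ∷ []) ⋆ ψ n ⟦ ws ⟧* ∼ ψ n ⟦ w ∷ ws ⟧* ⊕ ∑ₗ (ψ n ∘ ⟦_⟧*) (replaceEach (w ∙_) ws)
      ψ¹⋆ψ-⟦⟧ w ws ∣ws∣≤n =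
        ∼-trans (ψ¹⋆ψ n μ n!⁻¹ ⟦ w ⟧ ⟦ ws ⟧* (≡.subst (ℕ._≤ n) (≡.sym (List.length-map ⟦_⟧ ws)) ∣ws∣≤n))
                (⊕-cong ∼-refl (∼-sym (∑ψ-⟦⟧ n w ws)))

      totalDeg-∈replaceEach : ∀ w ws → All (λ zs → totalDeg zs ≡ totalDeg (w ∷ ws)) (replaceEach (w ∙_) ws)
      totalDeg-∈replaceEach w = fold-∈replaceEach ℕ.+-0-commutativeMonoid (deg w) (deg-∙ w)

      -- Induction on the length of ws: the product formula expresses ψ n ⟦ w ∷ ws ⟧* through
      -- ψ n [ ⟦ w ⟧ ] ⋆ ψ n ⟦ ws ⟧* and terms with one factor fewer but the same total degree.
      generated-ψ : ∀ D → (∀ w → deg w ℕ.< D → G (ψ n (⟦ w ⟧ ∷ []))) → ∀ ws → totalDeg ws ℕ.< D → G (ψ n ⟦ ws ⟧*)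
      generated-ψ D ψ¹∈G ws = go (length ws) ws ≡.refl
        where
        go : ∀ j ws → length ws ≡ j → totalDeg ws ℕ.< D → G (ψ n ⟦ ws ⟧*)
        go zero    []       _      _ = g-unit
        go (suc j) (w ∷ ws) ∣w∷ws∣ deg< with length ws ℕ.<? n
        ... | yes ∣ws∣<n = G-difference (ψ¹⋆ψ-⟦⟧ w ws (ℕ.<⇒≤ ∣ws∣<n))
          (g-⋆ (ψ¹∈G w (ℕ.≤-<-trans (ℕ.m≤m+n _ _) deg<) ) (go j ws ∣ws∣≡j (ℕ.≤-<-trans (ℕ.m≤n+m _ _) deg<)))
          (G-∑ₗ (All.zipWith (λ (∣zs∣≡∣ws∣ , deg-zs) → go j _ (≡.trans ∣zs∣≡∣ws∣ ∣ws∣≡j) (≡.subst (ℕ._< D) (≡.sym deg-zs) deg<))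
                             (length-∈replaceEach (w ∙_) ws , totalDeg-∈replaceEach w ws)))
          where ∣ws∣≡j = ℕ.suc-injective ∣w∷ws∣
        ... | no ∣ws∣≮n = g-∼ (∼-sym (ψ-vanish n ⟦ w ∷ ws ⟧* (s≤s (≡.subst (n ℕ.≤_) (≡.sym (List.length-map ⟦_⟧ ws)) (ℕ.≮⇒≥ ∣ws∣≮n))))) G-𝟘

    module _ (ψ∈G : ∀ xs → G (ψ n xs)) where

      Prod¹Span⊆G : ∀ {x} → Prod¹Span n x → G x
      Prod¹Span⊆G (prod¹-span xs ≡.refl) = g-∼ ψ∼prod¹ (ψ∈G xs)
        where
        ψ∼prod¹ : ψ (length xs) xs ∼ prod¹ xs
        ψ∼prod¹ = begin
          ψ (length xs) xs                                       ≈⟨ ψ-split (length xs) xs ℕ.≤-refl ⟩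
          prod¹ xs ⊗ [ 1ᴿ ]^[ length xs ∸ length xs ]           ≡⟨ ≡.cong (λ m → prod¹ xs ⊗ [ 1ᴿ ]^[ m ]) (ℕ.n∸n≡0 (length xs)) ⟩
          prod¹ xs ⊗ [ 1ᴿ ]^[ 0 ]                                ≈⟨ ⊗-cong ∼-refl (dp-zero 1ᴿ) ⟩
          prod¹ xs ⊗ 𝟙                                           ≈⟨ *-identityʳ _ ⟩
          prod¹ xs                                               ∎
      Prod¹Span⊆G 𝟘-span          = G-𝟘
      Prod¹Span⊆G (⊕-span x∈ y∈)  = g-⊕ (Prod¹Span⊆G x∈) (Prod¹Span⊆G y∈)
      Prod¹Span⊆G (⊙-span α x∈)   = g-⊙ α (Prod¹Span⊆G x∈)
      Prod¹Span⊆G (∼-span eq x∈)  = g-∼ eq (Prod¹Span⊆G x∈)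

      InΓ⊆G : ∀ {x} → InΓ n x → G x
      InΓ⊆G (span-mono x∈M) = G-!⁻¹ ℕ.≤-refl (Prod¹Span⊆G (Monomial⇒Prod¹Span x∈M))
      InΓ⊆G span-𝟘          = G-𝟘
      InΓ⊆G (span-⊕ x∈ y∈)  = g-⊕ (InΓ⊆G x∈) (InΓ⊆G y∈)
      InΓ⊆G (span-⊙ α x∈)   = g-⊙ α (InΓ⊆G x∈)
      InΓ⊆G (span-∼ eq x∈)  = g-∼ eq (InΓ⊆G x∈)

    module _ {ι} {I : Set ι} (r : I → R) where

      private
        υ¹ : List⁺ I → Tm
        υ¹ w = oneTimes n (monomial A r w)

      MonomialSpan⇒ψ¹∈G : (∀ w → G (υ¹ w)) → ∀ {x} → MonomialSpan r x → G (ψ n (x ∷ []))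
      MonomialSpan⇒ψ¹∈G υ¹∈G (monomial-span w) = g-∼ (∼-sym (ψ¹≈oneTimes n _)) (υ¹∈G w)
      MonomialSpan⇒ψ¹∈G υ¹∈G 1-span            = g-∼ (∼-sym (ψ¹-1 n)) (G-⟪⟫ n g-unit)
      MonomialSpan⇒ψ¹∈G υ¹∈G (+-span x∈ y∈)    = g-∼ (∼-sym (ψ¹-+ n _ _)) (g-⊕ (MonomialSpan⇒ψ¹∈G υ¹∈G x∈) (MonomialSpan⇒ψ¹∈G υ¹∈G y∈))
      MonomialSpan⇒ψ¹∈G υ¹∈G (·-span α x∈)     = g-∼ (∼-sym (ψ¹-· n α _)) (g-⊙ α (MonomialSpan⇒ψ¹∈G υ¹∈G x∈))
      MonomialSpan⇒ψ¹∈G υ¹∈G (≈-span eq x∈)    = g-∼ (ψ-cong-head n [] eq) (MonomialSpan⇒ψ¹∈G υ¹∈G x∈)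

      Γ-generated : GeneratedBy A r → (∀ w → G (υ¹ w)) → ∀ x → InΓ n x → G x
      Γ-generated R=⟨r⟩ υ¹∈G _ = InΓ⊆G ψ∈G
        where
        -- No degree bound is needed here, so every factor is given degree 0.
        open Factors id _*ᴿ_ (λ _ _ → A.refl) (λ _ → 0) (λ _ _ → ≡.refl)
        ψ∈G : ∀ xs → G (ψ n xs)
        ψ∈G xs = ≡.subst (G ∘ ψ n) (List.map-id xs)
          (generated-ψ (suc (totalDeg xs)) (λ y _ → MonomialSpan⇒ψ¹∈G υ¹∈G (GeneratedR⇒MonomialSpan r (R=⟨r⟩ y))) xs ℕ.≤-refl)

      module _ (comm : IsCommutativeAlg A) (short∈G : ∀ w → List⁺.length w ℕ.≤ n → G (υ¹ w)) where

        *-commutativeMonoid : CommutativeMonoid a ℓa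
        *-commutativeMonoid = record { isCommutativeMonoid = record { isMonoid = A.*-isMonoid ; comm = comm } }

        open Factors (monomial A r) _⁺++⁺_ (monomial-⁺++⁺ r) List⁺.length List⁺.length-⁺++⁺

        ∏ : List (List⁺ I) → R
        ∏ = fold *-commutativeMonoid (monomial A r)

        split-word : ∀ m w → m ℕ.< List⁺.length w →
                     Σ (List (List⁺ I)) λ ws → length ws ≡ suc m × totalDeg ws ≡ List⁺.length w × ∏ ws ≈ᴿ monomial A r w
        split-word zero    w            _           = w ∷ [] , ≡.refl , ℕ.+-identityʳ _ , A.*-identityʳ _
        split-word (suc m) (i ∷ j ∷ js) (s≤s m<∣w∣) with split-word m (j ∷ js) m<∣w∣
        ... | ws , ∣ws∣ , deg-ws , ∏ws = (i ∷ []) ∷ ws , ≡.cong suc ∣ws∣ , ≡.cong suc deg-ws , A.*-cong A.refl ∏ws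

        infix 4 _≋_
        _≋_ : Tm → Tm → Set (c ⊔ ℓ ⊔ a ⊔ ℓa ⊔ s)
        x ≋ y = G (x ⊕ ⊖ y)

        ∼⇒≋ : ∀ {x y} → x ∼ y → x ≋ y
        ∼⇒≋ {x} {y} x∼y = g-∼ (∼-trans (∼-sym (-‿inverseʳ y)) (⊕-cong (∼-sym x∼y) ∼-refl)) G-𝟘

        ≋-respʳ : ∀ {x y y′} → x ≋ y → y ∼ y′ → x ≋ y′
        ≋-respʳ x≋y y∼y′ = g-∼ (⊕-cong ∼-refl (⊖-cong y∼y′)) x≋y

        ≋-∑ₗ : ∀ {b} {B : Set b} {F : B → Tm} {ls y} → All (λ l → F l ≋ y) ls → ∑ₗ F ls ≋ ⟪ length ls ⟫ ⊗ y
        ≋-∑ₗ {y = y} []               = ∼⇒≋ (∼-sym (zeroˡ y))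
        ≋-∑ₗ {F = F} {l ∷ ls} {y} (Fl≋y ∷ Fls≋y) = g-∼ regroup (g-⊕ Fl≋y (≋-∑ₗ Fls≋y))
          where
          regroup : (F l ⊕ ⊖ y) ⊕ (∑ₗ F ls ⊕ ⊖ (⟪ length ls ⟫ ⊗ y)) ∼ (F l ⊕ ∑ₗ F ls) ⊕ ⊖ (⟪ suc (length ls) ⟫ ⊗ y)
          regroup = ∼-trans (solve 4 (λ f y s m → (f :- y) :+ (s :- m :* y) := (f :+ s) :- (con (+ 1) :+ m) :* y) ∼-refl _ _ _ _)
                            (⊕-cong ∼-refl (⊖-cong (⊗-cong (∼-sym (⟪⟫-suc (length ls))) ∼-refl)))

        ≋-difference : ∀ {p x t y} → p ∼ x ⊕ t → G p → t ≋ y → x ≋ ⊖ y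
        ≋-difference {p} {x} {t} {y} p∼x+t p∈G t≋y = g-∼ regroup (g-⊕ p∈G (G-⊖ t≋y))
          where
          regroup : p ⊕ ⊖ (t ⊕ ⊖ y) ∼ x ⊕ ⊖ ⊖ y
          regroup = ∼-trans (⊕-cong p∼x+t ∼-refl) (solve 3 (λ x t y → (x :+ t) :- (t :- y) := x :- (:- y)) ∼-refl x t y)

        ⊖^[_]_ : ℕ → Tm → Tm
        ⊖^[ zero  ] x = x
        ⊖^[ suc j ] x = ⊖ ⊖^[ j ] x

        ⊖^-cong : ∀ j {x y} → x ∼ y → ⊖^[ j ] x ∼ ⊖^[ j ] y
        ⊖^-cong zero    x∼y = x∼y
        ⊖^-cong (suc j) x∼y = ⊖-cong (⊖^-cong j x∼y)

        ⊗-⊖^ : ∀ j y x → y ⊗ ⊖^[ j ] x ∼ ⊖^[ j ] (y ⊗ x)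
        ⊗-⊖^ zero    y x = ∼-refl
        ⊗-⊖^ (suc j) y x = ∼-trans (∼-sym (-‿distribʳ-* y _)) (⊖-cong (⊗-⊖^ j y x))

        G-⊖^⁻¹ : ∀ j {x} → G (⊖^[ j ] x) → G x
        G-⊖^⁻¹ zero    x∈G = x∈G
        G-⊖^⁻¹ (suc j) x∈G = G-⊖^⁻¹ j (G-⊖⁻¹ x∈G)

        module _ (D : ℕ) (shorter∈G : ∀ w → List⁺.length w ℕ.< D → G (ψ n (monomial A r w ∷ []))) where

          ψ-words : ∀ j ws → length ws ≡ suc j → j ℕ.≤ n → totalDeg ws ≡ D →
                    ψ n ⟦ ws ⟧* ≋ ⊖^[ j ] (⟪ j ! ⟫ ⊗ ψ n (∏ ws ∷ []))
          ψ-words zero    (w ∷ [])     _ _ _ = ∼⇒≋ (∼-trans (ψ-cong-head n [] (A.sym (A.*-identityʳ _))) (∼-sym (⊗-idˡ _)))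
          ψ-words (suc j) (w ∷ v ∷ vs) ∣w∷ws∣ 1+j≤n deg≡D =
            ≋-respʳ (≋-difference (ψ¹⋆ψ-⟦⟧ w ws ∣ws∣≤n) (g-⋆ ψ¹w∈G ψws∈G) (≋-respʳ (≋-∑ₗ each) count)) alternate
            where
            ws = v ∷ vs
            T = ψ n (∏ (w ∷ ws) ∷ [])
            ∣ws∣≡1+j = ℕ.suc-injective ∣w∷ws∣
            ∣ws∣≤n = ≡.subst (ℕ._≤ n) (≡.sym ∣ws∣≡1+j) 1+j≤n
            ψ¹w∈G = shorter∈G w (≡.subst (List⁺.length w ℕ.<_) deg≡D (ℕ.m<m+n _ z<s))
            ψws∈G = generated-ψ D shorter∈G ws (≡.subst (totalDeg ws ℕ.<_) deg≡D (ℕ.m<n+m _ z<s))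
            each : All (λ zs → ψ n ⟦ zs ⟧* ≋ ⊖^[ j ] (⟪ j ! ⟫ ⊗ T)) (replaceEach (w ⁺++⁺_) ws)
            each = All.zipWith
              (λ ((∣zs∣≡∣ws∣ , deg-zs) , ∏zs) → ≋-respʳ
                (ψ-words j _ (≡.trans ∣zs∣≡∣ws∣ ∣ws∣≡1+j) (ℕ.<⇒≤ 1+j≤n) (≡.trans deg-zs deg≡D))
                (⊖^-cong j (⊗-cong ∼-refl (ψ-cong-head n [] ∏zs))))
              (All.zip (length-∈replaceEach (w ⁺++⁺_) ws , totalDeg-∈replaceEach w ws) ,
               fold-∈replaceEach *-commutativeMonoid _ (monomial-⁺++⁺ r w) ws)
            count : ⟪ length (replaceEach (w ⁺++⁺_) ws) ⟫ ⊗ ⊖^[ j ] (⟪ j ! ⟫ ⊗ T) ∼ ⟪ suc j ⟫ ⊗ ⊖^[ j ] (⟪ j ! ⟫ ⊗ T)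
            count = ∼-reflexive
              (≡.cong (λ m → ⟪ m ⟫ ⊗ ⊖^[ j ] (⟪ j ! ⟫ ⊗ T)) (≡.trans (length-replaceEach _ ws) ∣ws∣≡1+j))
            alternate : ⊖ (⟪ suc j ⟫ ⊗ ⊖^[ j ] (⟪ j ! ⟫ ⊗ T)) ∼ ⊖^[ suc j ] (⟪ suc j ! ⟫ ⊗ T)
            alternate = ⊖-cong (∼-trans (⊗-⊖^ j _ _) (⊖^-cong j (∼-trans (∼-sym (⊗-assoc _ _ _)) (⊗-cong (∼-sym (⟪⟫-* (suc j) (j !))) ∼-refl))))

          -- Split w into n + 1 words: their ψ vanishes, which leaves ± n! ψ n [ w ] generated.
          long∈G : ∀ w → List⁺.length w ≡ D → n ℕ.< D → G (ψ n (monomial A r w ∷ []))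
          long∈G w ∣w∣≡D n<D with split-word n w (≡.subst (n ℕ.<_) (≡.sym ∣w∣≡D) n<D)
          ... | ws , ∣ws∣≡1+n , deg-ws , ∏ws≈w = g-∼ (ψ-cong-head n [] ∏ws≈w)
            (G-!⁻¹ ℕ.≤-refl (G-⊖^⁻¹ n (G-⊖⁻¹ (g-∼ (∼-trans (⊕-cong ψws∼0 ∼-refl) (⊕-idˡ _))
              (ψ-words n ws ∣ws∣≡1+n ℕ.≤-refl (≡.trans deg-ws ∣w∣≡D))))))
            where
            ψws∼0 : ψ n ⟦ ws ⟧* ∼ 𝟘
            ψws∼0 = ψ-vanish n ⟦ ws ⟧* (≡.subst (n ℕ.<_) (≡.sym (≡.trans (List.length-map _ ws) ∣ws∣≡1+n)) ℕ.≤-refl)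

        ψ¹∈G : ∀ D w → List⁺.length w ℕ.< D → G (ψ n (monomial A r w ∷ []))
        ψ¹∈G (suc D) w (s≤s ∣w∣≤D) with List⁺.length w ℕ.≤? n
        ... | yes ∣w∣≤n = g-∼ (∼-sym (ψ¹≈oneTimes n _)) (short∈G w ∣w∣≤n)
        ... | no  ∣w∣≰n = long∈G (List⁺.length w) (λ v ∣v∣<∣w∣ → ψ¹∈G D v (ℕ.<-≤-trans ∣v∣<∣w∣ ∣w∣≤D)) w ≡.refl (ℕ.≰⇒> ∣w∣≰n)

        υ¹∈G : ∀ w → G (υ¹ w)
        υ¹∈G w = g-∼ (ψ¹≈oneTimes n _) (ψ¹∈G (suc (List⁺.length w)) w ℕ.≤-refl)

mainTheorem8 : ∀ {c ℓ a ℓa ι} (K : CommutativeRing c ℓ) (A : KAlgebra K a ℓa) (n : ℕ) →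
    FactorialInvertible K n →
    {I : Set ι} (r : I → KAlgebra.Carrier A) → GeneratedBy A r →
    (μ : Divided.GammaMult K A n) →
    (∀ x → Divided.InΓ K A n x → Divided.Generated K A μ (Divided.MonoGens K A r n) x)
    × (IsCommutativeAlg A →
    ∀ x → Divided.InΓ K A n x → Divided.Generated K A μ (Divided.MonoGensBounded K A r n) x)
mainTheorem8 K A n n!⁻¹ r R=⟨r⟩ μ =
    Unbounded.Γ-generated r R=⟨r⟩ (λ w → g-gen (w , ≡.refl))
  , λ comm → Short.Γ-generated r R=⟨r⟩ (Short.υ¹∈G r comm (λ w ∣w∣≤n → g-gen (w , ∣w∣≤n , ≡.refl)))
  where
  open Divided K A using (g-gen)
  module Unbounded = Generation K A n μ n!⁻¹ (Divided.MonoGens K A r n)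
  module Short     = Generation K A n μ n!⁻¹ (Divided.MonoGensBounded K A r n)
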